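{- For integers $n\geqslant 1$ and $t,s,r$, let $v(n,t,s,r)=\#\{\pi\in\mathfrak{S}_n:\operatorname{cval}(\pi)=t,\ \operatorname{cyc}(\pi)=s,\ \operatorname{fix}(\pi)=r\}$ (so $v(n,t,s,r)=0$ whenever no such permutation exists). Then for all $n\geqslant 1$ and all $t,s,r$, \begin{align*} v(n+1,t,s,r)&=(2t+2s-2r)\,v(n,t,s,r)+v(n,t,s-1,r-1)\\ &\quad+(r+1)\,v(n,t,s,r+1)+(n+2-2t-2s+r)\,v(n,t-1,s,r). \end{align*}
   Context: $\mathfrak{S}_n$ is the set of permutations of $[n]=\{1,\dots,n\}$. Every permutation is written in standard cycle decomposition: each cycle is written with its smallest entry first, and cycles are listed in increasing order of their smallest entries. For a cycle $(c_1,\dots,c_\ell)$ so written, an entry $c_m$ with $2\leqslant m\leqslant \ell-1$ is a cyclic valley if $c_{m-1}>c_m<c_{m+1}$. $\operatorname{cval}(\pi)$ is the total number of cyclic valleys over all cycles of $\pi$, $\operatorname{cyc}(\pi)$ the number of cycles, and $\operatorname{fix}(\pi)$ the number of fixed points of $\pi$. -}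

module Defs where

open import Data.Bool using (Bool; true; false; _∧_; if_then_else_)
open import Data.Nat using (ℕ; zero; suc; _+_; _<ᵇ_)
open import Data.Fin using (Fin; toℕ; _≟_)
open import Data.List using (List; []; _∷_; map; filter; length; foldr; concatMap; allFin)
open import Data.Vec using (Vec; lookup; []; _∷_)
open import Data.Integer using (ℤ; +_; _≟_)
open import Relation.Nullary.Decidable using (⌊_⌋)

countᵇ : {A : Set} → (A → Bool) → List A → ℕ
countᵇ p [] = 0
countᵇ p (x ∷ xs) = (if p x then 1 else 0) + countᵇ p xs

allᵇ : {A : Set} → (A → Bool) → List A → Bool
allᵇ p xs = foldr (λ x b → p x ∧ b) true xs

allVecs : (n m : ℕ) → List (Vec (Fin n) m)
allVecs n zero = [] ∷ []
allVecs n (suc m) = concatMap (λ x → map (x ∷_) (allVecs n m)) (allFin n)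

-- A vector of length n with entries in Fin n, viewed as a map [n] → [n],
-- is a permutation iff it is injective.
isPerm : {n : ℕ} → Vec (Fin n) n → Bool
isPerm {n} v = allᵇ (λ i → allᵇ (λ j → if ⌊ lookup v i Data.Fin.≟ lookup v j ⌋ then ⌊ i Data.Fin.≟ j ⌋ else true) (allFin n)) (allFin n)

Sym : (n : ℕ) → List (Vec (Fin n) n)
Sym n = filter (λ v → Data.Bool._≟_ (isPerm v) true) (allVecs n n)

orbitFrom : {n : ℕ} → (Fin n → Fin n) → ℕ → Fin n → Fin n → List (Fin n)
orbitFrom f zero start x = []
orbitFrom f (suc k) start x =
  x ∷ (if ⌊ f x Data.Fin.≟ start ⌋ then [] else orbitFrom f k start (f x))

cycleOf : {n : ℕ} → Vec (Fin n) n → Fin n → List (Fin n)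
cycleOf {n} π x = orbitFrom (lookup π) n x x

isCycleMin : {n : ℕ} → Vec (Fin n) n → Fin n → Bool
isCycleMin π x = allᵇ (λ y → Data.Bool.not (toℕ y <ᵇ toℕ x)) (cycleOf π x)

-- Standard cycle decomposition: each cycle starts with its smallest entry,
-- cycles listed in increasing order of smallest entries.
cycles : {n : ℕ} → Vec (Fin n) n → List (List (Fin n))
cycles {n} π = map (cycleOf π) (filter (λ x → Data.Bool._≟_ (isCycleMin π x) true) (allFin n))

valleys : {n : ℕ} → List (Fin n) → ℕ
valleys (a ∷ b ∷ c ∷ rest) =
  (if (toℕ b <ᵇ toℕ a) ∧ (toℕ b <ᵇ toℕ c) then 1 else 0) + valleys (b ∷ c ∷ rest)
valleys _ = 0

cval : {n : ℕ} → Vec (Fin n) n → ℕ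
cval π = foldr _+_ 0 (map valleys (cycles π))

cyc : {n : ℕ} → Vec (Fin n) n → ℕ
cyc π = length (cycles π)

fix : {n : ℕ} → Vec (Fin n) n → ℕ
fix {n} π = countᵇ (λ x → ⌊ lookup π x Data.Fin.≟ x ⌋) (allFin n)

v : ℕ → ℤ → ℤ → ℤ → ℕ
v n t s r = countᵇ (λ π → ⌊ + cval π Data.Integer.≟ t ⌋ ∧ ⌊ + cyc π Data.Integer.≟ s ⌋ ∧ ⌊ + fix π Data.Integer.≟ r ⌋) (Sym n)

-- Every permutation of [n+1] arises exactly once from some σ ∈ 𝔖ₙ by inserting the letter n+1,
-- either as a new fixed point or directly after some x in its cycle. The new fixed point adds one
-- cycle and one fixed point. Inserting after a fixed point x turns it into a 2-cycle and removes a
-- fixed point. Inserting after a non-fixed x changes neither cyc nor fix and raises cval by 0 or 1,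
-- since a letter larger than all others destroys no valley and creates at most one. In a cycle of
-- length ≥ 2 with v cyclic valleys, written from its minimum, exactly 2v + 2 insertion positions
-- leave cval unchanged; giving each fixed point weight 2, σ therefore has
-- 2·cval + 2·cyc − 2·fix such neutral positions, and the remaining n − fix − neutral positions raise
-- cval by one. Sorting the insertions by the statistics of σ gives the four terms of the recurrence.
module Submission where

open import Defs
open import Data.Bool using (Bool; true; false; _∧_; not; if_then_else_) renaming (_≟_ to _≟ᵇ_)
open import Data.Bool.Properties using (∧-identityʳ; ∧-comm)
open import Data.Empty using (⊥; ⊥-elim)
open import Data.Fin using (Fin; toℕ; fromℕ; inject₁) renaming (zero to fzero; suc to fsuc; _≟_ to _≟ᶠ_)
open import Data.Fin.Properties using (toℕ-injective; toℕ-inject₁; toℕ-fromℕ; toℕ<n; inject₁-injective; fromℕ≢inject₁; pigeonhole)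
open import Data.List using (List; []; _∷_; map; filter; length; concatMap; allFin; _++_; tabulate)
import Data.List.Properties
open import Data.List.Relation.Binary.BagAndSetEquality using (∼bag⇒↭)
import Data.List.Relation.Binary.Permutation.Propositional.Properties as ↭
open import Data.List.Membership.Propositional.Properties.WithK using (unique∧set⇒bag)
open import Data.List.Relation.Unary.All.Properties using (All¬⇒¬Any; ¬Any⇒All¬)
import Data.List.Membership.DecPropositional as DecMem
open import Data.List.Membership.Propositional using (_∈_; _∉_; find; lose)
open import Data.List.Membership.Propositional.Properties using (∈-map⁺; ∈-map⁻; ∈-filter⁺; ∈-filter⁻; ∈-allFin; ∈-concatMap⁺; ∈-concatMap⁻)
open import Data.List.Relation.Unary.All using (All; []; _∷_)
open import Data.List.Relation.Unary.AllPairs using ([]; _∷_)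
open import Data.List.Relation.Unary.Any using (here; there)
open import Data.List.Relation.Unary.Linked using (Linked; _∷_)
import Data.List.Relation.Unary.Linked as Linked
open import Data.List.Relation.Unary.Linked.Properties using (AllPairs⇒Linked)
open import Data.List.Relation.Unary.Unique.Propositional using (Unique)
open import Data.List.Relation.Unary.Unique.Propositional.Properties using (++⁺; map⁺; filter⁺; allFin⁺)
open import Data.Maybe using (Maybe; just; nothing)
open import Data.Nat using (ℕ; zero; suc; _+_; _*_; _≤_; _<_; _≥_; _<ᵇ_; _≡ᵇ_; z≤n; s≤s)
open import Data.Nat.ListAction using (sum)
open import Data.Nat.ListAction.Properties using (sum-++; sum-↭)
open import Data.Nat.Properties
open import Data.Nat.Tactic.RingSolver
open import Data.Product using (∃; ∃-syntax; _×_; _,_; proj₁; proj₂)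
open import Data.Sum using (inj₁; inj₂)
open import Data.Vec using (Vec; lookup) renaming (tabulate to vtab; [] to v[]; _∷_ to _v∷_)
open import Data.Vec.Properties using (lookup∘tabulate; tabulate∘lookup; tabulate-cong)
import Data.Vec.Properties
open import Function using (_∘_; id)
open import Function.Bundles using (mk⇔)
open import Function.Definitions using (Injective)
open import Relation.Nullary using (¬_; Dec; yes; no)
open import Relation.Nullary.Decidable using (⌊_⌋; isYes≗does; dec-true; dec-false)
open import Relation.Binary.PropositionalEquality

+-interchange : ∀ a b c d → (a + b) + (c + d) ≡ (a + c) + (b + d)
+-interchange = solve-∀

+-leftComm : ∀ a b c → a + (b + c) ≡ b + (a + c)
+-leftComm = solve-∀

∑ : {A : Set} → (A → ℕ) → List A → ℕ
∑ f xs = sum (map f xs)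

𝟙 : Bool → ℕ
𝟙 b = if b then 1 else 0

⌊⌋-true : {P : Set} (d : Dec P) → P → ⌊ d ⌋ ≡ true
⌊⌋-true d p = trans (isYes≗does d) (dec-true d p)

⌊⌋-false : {P : Set} (d : Dec P) → ¬ P → ⌊ d ⌋ ≡ false
⌊⌋-false d ¬p = trans (isYes≗does d) (dec-false d ¬p)

⌊⌋-cong : {P Q : Set} → (P → Q) → (Q → P) → (d₁ : Dec P) (d₂ : Dec Q) → ⌊ d₁ ⌋ ≡ ⌊ d₂ ⌋
⌊⌋-cong P→Q Q→P (yes _) (yes _) = refl
⌊⌋-cong P→Q Q→P (no _) (no _) = refl
⌊⌋-cong P→Q Q→P (yes p) (no ¬q) = ⊥-elim (¬q (P→Q p))
⌊⌋-cong P→Q Q→P (no ¬p) (yes q) = ⊥-elim (¬p (Q→P q))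

countᵇ≡∑ : {A : Set} (p : A → Bool) (xs : List A) → countᵇ p xs ≡ ∑ (𝟙 ∘ p) xs
countᵇ≡∑ p [] = refl
countᵇ≡∑ p (x ∷ xs) = cong (𝟙 (p x) +_) (countᵇ≡∑ p xs)

∑-++ : {A : Set} (f : A → ℕ) (xs ys : List A) → ∑ f (xs ++ ys) ≡ ∑ f xs + ∑ f ys
∑-++ f xs ys = trans (cong sum (Data.List.Properties.map-++ f xs ys)) (sum-++ (map f xs) (map f ys))

∑-map : {A B : Set} (h : B → ℕ) (f : A → B) (xs : List A) → ∑ h (map f xs) ≡ ∑ (h ∘ f) xs
∑-map h f xs = cong sum (sym (Data.List.Properties.map-∘ xs))

∑-concatMap : {A B : Set} (h : B → ℕ) (f : A → List B) (xs : List A) →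
  ∑ h (concatMap f xs) ≡ ∑ (λ x → ∑ h (f x)) xs
∑-concatMap h f [] = refl
∑-concatMap h f (x ∷ xs) = trans (∑-++ h (f x) (concatMap f xs)) (cong (∑ h (f x) +_) (∑-concatMap h f xs))

∑-cong : {A : Set} {f g : A → ℕ} (xs : List A) → (∀ x → x ∈ xs → f x ≡ g x) → ∑ f xs ≡ ∑ g xs
∑-cong [] e = refl
∑-cong (x ∷ xs) e = cong₂ _+_ (e x (here refl)) (∑-cong xs (λ y m → e y (there m)))

∑-+ : {A : Set} (f g : A → ℕ) (xs : List A) → ∑ (λ x → f x + g x) xs ≡ ∑ f xs + ∑ g xs
∑-+ f g [] = refl
∑-+ f g (x ∷ xs) = trans (cong (f x + g x +_) (∑-+ f g xs)) (+-interchange (f x) (g x) (∑ f xs) (∑ g xs))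

∑-*ˡ : {A : Set} (c : ℕ) (f : A → ℕ) (xs : List A) → ∑ (λ x → c * f x) xs ≡ c * ∑ f xs
∑-*ˡ c f [] = sym (*-zeroʳ c)
∑-*ˡ c f (x ∷ xs) = trans (cong (c * f x +_) (∑-*ˡ c f xs)) (sym (*-distribˡ-+ c (f x) _))

∑-zero : {A : Set} (f : A → ℕ) (xs : List A) → (∀ x → x ∈ xs → f x ≡ 0) → ∑ f xs ≡ 0
∑-zero f xs e = trans (∑-cong xs e) (∑-*ˡ 0 f xs)

∑-filter : {A : Set} (h : A → ℕ) (p : A → Bool) (xs : List A) →
  ∑ h (filter (λ x → p x ≟ᵇ true) xs) ≡ ∑ (λ x → if p x then h x else 0) xs
∑-filter h p [] = refl
∑-filter h p (x ∷ xs) with p x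
... | true = cong (h x +_) (∑-filter h p xs)
... | false = ∑-filter h p xs

length≡∑1 : {A : Set} (xs : List A) → length xs ≡ ∑ (λ _ → 1) xs
length≡∑1 [] = refl
length≡∑1 (x ∷ xs) = cong suc (length≡∑1 xs)

Unique-tail : {A : Set} {x : A} {xs : List A} → Unique (x ∷ xs) → Unique xs
Unique-tail (_ ∷ u) = u

Unique-head : {A : Set} {x : A} {xs : List A} → Unique (x ∷ xs) → x ∉ xs
Unique-head (x≢xs ∷ _) = All¬⇒¬Any x≢xs

Unique-cons : {A : Set} {x : A} {xs : List A} → x ∉ xs → Unique xs → Unique (x ∷ xs)
Unique-cons x∉xs u = ¬Any⇒All¬ _ x∉xs ∷ u

∑-sameElements : {A : Set} (h : A → ℕ) (xs ys : List A) → Unique xs → Unique ys →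
  (∀ z → z ∈ xs → z ∈ ys) → (∀ z → z ∈ ys → z ∈ xs) → ∑ h xs ≡ ∑ h ys
∑-sameElements h xs ys ux uy xs⊆ys ys⊆xs =
  sum-↭ (↭.map⁺ h (∼bag⇒↭ (unique∧set⇒bag ux uy (mk⇔ (xs⊆ys _) (ys⊆xs _)))))

∑-single : {A : Set} (f : A → ℕ) (xs : List A) (y : A) → Unique xs → y ∈ xs →
  (∀ z → z ∈ xs → z ≢ y → f z ≡ 0) → ∑ f xs ≡ f y
∑-single f (x ∷ xs) y u (here refl) e =
  trans (cong (f x +_) (∑-zero f xs (λ z m → e z (there m) (λ eq → Unique-head u (subst (_∈ xs) eq m))))) (+-identityʳ _)
∑-single f (x ∷ xs) y u (there m) e =
  cong₂ _+_ (e x (here refl) (λ eq → Unique-head u (subst (_∈ xs) (sym eq) m))) (∑-single f xs y (Unique-tail u) m (λ z m' → e z (there m')))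

∑-except : {A : Set} (h h′ : A → ℕ) (x : A) (L : List A) → Unique L → x ∈ L →
  (∀ z → z ∈ L → z ≢ x → h′ z ≡ h z) → h′ x ≡ 0 → ∑ h′ L + h x ≡ ∑ h L
∑-except h h′ x (w ∷ L) u (here refl) agree h′x≡0 rewrite h′x≡0 =
  trans (+-comm (∑ h′ L) (h w)) (cong (h w +_) (∑-cong L (λ z m → agree z (there m) (λ eq → Unique-head u (subst (_∈ L) eq m)))))
∑-except h h′ x (w ∷ L) u (there m) agree h′x≡0 =
  trans (+-assoc (h′ w) _ _) (cong₂ _+_ (agree w (here refl) (λ eq → Unique-head u (subst (_∈ L) (sym eq) m)))
    (∑-except h h′ x L (Unique-tail u) m (λ z m′ → agree z (there m′)) h′x≡0))

∑-tabulate-suc : {A : Set} {n : ℕ} (h : A → ℕ) (g : Fin (suc n) → A) →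
  ∑ h (tabulate g) ≡ h (g (fromℕ n)) + ∑ h (tabulate (g ∘ inject₁))
∑-tabulate-suc {n = zero} h g = refl
∑-tabulate-suc {n = suc n} h g =
  trans (cong (h (g fzero) +_) (∑-tabulate-suc h (g ∘ fsuc))) (+-leftComm (h (g fzero)) (h (g (fsuc (fromℕ n)))) (∑ h (tabulate (g ∘ fsuc ∘ inject₁))))

∑-allFin-suc : {n : ℕ} (h : Fin (suc n) → ℕ) → ∑ h (allFin (suc n)) ≡ h (fromℕ n) + ∑ (h ∘ inject₁) (allFin n)
∑-allFin-suc {n} h = trans (∑-tabulate-suc h id)
  (cong (h (fromℕ n) +_) (trans (cong (∑ h) (sym (Data.List.Properties.map-tabulate id inject₁))) (∑-map h inject₁ (allFin n))))

Inj : {A B : Set} → (A → B) → Set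
Inj = Injective _≡_ _≡_

∑-allFin-bijection : {n : ℕ} (f : Fin n → Fin n) → Inj f → (∀ y → ∃[ x ] (f x ≡ y)) → (g : Fin n → ℕ) →
  ∑ g (allFin n) ≡ ∑ (g ∘ f) (allFin n)
∑-allFin-bijection {n} f inj surj g = trans (∑-sameElements g (allFin n) (map f (allFin n)) (allFin⁺ n) (map⁺ inj (allFin⁺ n))
    (λ z _ → subst (_∈ map f (allFin n)) (proj₂ (surj z)) (∈-map⁺ f (∈-allFin (proj₁ (surj z)))))
    (λ z _ → ∈-allFin z))
  (∑-map g f (allFin n))

allᵇ-elim : {A : Set} (p : A → Bool) (xs : List A) → allᵇ p xs ≡ true → ∀ x → x ∈ xs → p x ≡ true
allᵇ-elim p (y ∷ xs) e x m with p y in eq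
allᵇ-elim p (y ∷ xs) e x (here refl) | true = eq
allᵇ-elim p (y ∷ xs) e x (there m) | true = allᵇ-elim p xs e x m
allᵇ-elim p (y ∷ xs) () x m | false

allᵇ-intro : {A : Set} (p : A → Bool) (xs : List A) → (∀ x → x ∈ xs → p x ≡ true) → allᵇ p xs ≡ true
allᵇ-intro p [] h = refl
allᵇ-intro p (y ∷ xs) h rewrite h y (here refl) = allᵇ-intro p xs (λ x m → h x (there m))

lookup-ext : {A : Set} {n : ℕ} (v w : Vec A n) → (∀ i → lookup v i ≡ lookup w i) → v ≡ w
lookup-ext v w e = trans (sym (tabulate∘lookup v)) (trans (tabulate-cong e) (tabulate∘lookup w))

isPerm⇒Inj : {n : ℕ} (v : Vec (Fin n) n) → isPerm v ≡ true → Inj (lookup v)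
isPerm⇒Inj {n} v e {i} {j} eq = go (allᵇ-elim _ (allFin n) (allᵇ-elim _ (allFin n) e i (∈-allFin i)) j (∈-allFin j))
  where
  false≢true : false ≢ true
  false≢true ()
  go : (if ⌊ lookup v i ≟ᶠ lookup v j ⌋ then ⌊ i ≟ᶠ j ⌋ else true) ≡ true → i ≡ j
  go h with lookup v i ≟ᶠ lookup v j
  ... | no ne = ⊥-elim (ne eq)
  ... | yes _ with i ≟ᶠ j
  ...   | yes ij = ij
  ...   | no _ = ⊥-elim (false≢true h)

Inj⇒isPerm : {n : ℕ} (v : Vec (Fin n) n) → Inj (lookup v) → isPerm v ≡ true
Inj⇒isPerm {n} v inj = allᵇ-intro _ (allFin n) (λ i _ → allᵇ-intro _ (allFin n) (λ j _ → go i j))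
  where
  go : ∀ i j → (if ⌊ lookup v i ≟ᶠ lookup v j ⌋ then ⌊ i ≟ᶠ j ⌋ else true) ≡ true
  go i j with lookup v i ≟ᶠ lookup v j
  ... | no _ = refl
  ... | yes eq with i ≟ᶠ j
  ...   | yes _ = refl
  ...   | no ne = ⊥-elim (ne (inj eq))

∈-concatMap-intro : {A B : Set} (f : A → List B) {x : A} {xs : List A} {y : B} → x ∈ xs → y ∈ f x → y ∈ concatMap f xs
∈-concatMap-intro f x∈xs y∈fx = ∈-concatMap⁺ f (lose x∈xs y∈fx)

∈-concatMap-elim : {A B : Set} (f : A → List B) (xs : List A) {y : B} → y ∈ concatMap f xs → ∃[ x ] (x ∈ xs × y ∈ f x)
∈-concatMap-elim f xs y∈ = find (∈-concatMap⁻ f {xs = xs} y∈)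

Unique-concatMap : {A B : Set} (f : A → List B) (xs : List A) → Unique xs → (∀ x → x ∈ xs → Unique (f x)) →
  (∀ x y a → x ∈ xs → y ∈ xs → a ∈ f x → a ∈ f y → x ≡ y) → Unique (concatMap f xs)
Unique-concatMap f [] u uf d = []
Unique-concatMap f (x ∷ xs) u uf d =
  ++⁺ (uf x (here refl)) (Unique-concatMap f xs (Unique-tail u) (λ y m → uf y (there m)) (λ a b c ma mb → d a b c (there ma) (there mb))) disj
  where
  disj : ∀ {v} → v ∈ f x × v ∈ concatMap f xs → ⊥
  disj (m1 , m2) with ∈-concatMap-elim f xs m2
  ... | y , my , m3 = Unique-head u (subst (_∈ xs) (sym (d x y _ (here refl) (there my) m1 m3)) my)

∈-allVecs : (n m : ℕ) (v : Vec (Fin n) m) → v ∈ allVecs n m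
∈-allVecs n zero v[] = here refl
∈-allVecs n (suc m) (x v∷ v) = ∈-concatMap-intro (λ x → map (x v∷_) (allVecs n m)) (∈-allFin x) (∈-map⁺ (x v∷_) (∈-allVecs n m v))

Unique-allVecs : (n m : ℕ) → Unique (allVecs n m)
Unique-allVecs n zero = [] ∷ []
Unique-allVecs n (suc m) = Unique-concatMap _ (allFin n) (allFin⁺ n)
  (λ x _ → map⁺ (λ e → proj₂ (Data.Vec.Properties.∷-injective e)) (Unique-allVecs n m))
  (λ x y a _ _ ma mb → heads≡ ma mb)
  where
  heads≡ : ∀ {x y a} → a ∈ map (x v∷_) (allVecs n m) → a ∈ map (y v∷_) (allVecs n m) → x ≡ y
  heads≡ ma mb with ∈-map⁻ _ ma | ∈-map⁻ _ mb
  ... | _ , _ , refl | _ , _ , e = proj₁ (Data.Vec.Properties.∷-injective e)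

Inj⇒∈-Sym : {n : ℕ} (v : Vec (Fin n) n) → Inj (lookup v) → v ∈ Sym n
Inj⇒∈-Sym {n} v inj = ∈-filter⁺ (λ v → isPerm v ≟ᵇ true) (∈-allVecs n n v) (Inj⇒isPerm v inj)

Sym⇒Inj : {n : ℕ} (v : Vec (Fin n) n) → v ∈ Sym n → Inj (lookup v)
Sym⇒Inj {n} v m = isPerm⇒Inj v (proj₂ (∈-filter⁻ (λ v → isPerm v ≟ᵇ true) {xs = allVecs n n} m))

Unique-Sym : (n : ℕ) → Unique (Sym n)
Unique-Sym n = filter⁺ (λ v → isPerm v ≟ᵇ true) (Unique-allVecs n n)

data View {n : ℕ} : Fin (suc n) → Set where
  old : (z : Fin n) → View (inject₁ z)
  new : View (fromℕ n)

view : {n : ℕ} (i : Fin (suc n)) → View i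
view {zero} fzero = new
view {suc n} fzero = old fzero
view {suc n} (fsuc i) with view i
... | old z = old (fsuc z)
... | new = new

view-inject₁ : {n : ℕ} (z : Fin n) → view (inject₁ z) ≡ old z
view-inject₁ {suc n} fzero = refl
view-inject₁ {suc n} (fsuc z) rewrite view-inject₁ z = refl

view-fromℕ : (n : ℕ) → view (fromℕ n) ≡ new
view-fromℕ zero = refl
view-fromℕ (suc n) rewrite view-fromℕ n = refl

-- The new letter fromℕ n is inserted into f at slot p: as a fixed point (p = nothing), or
-- into a cycle just before y (p = just y), i.e. between f⁻¹ y and y.
insertOld : {n : ℕ} (f : Fin n → Fin n) → Maybe (Fin n) → Fin n → Fin (suc n)
insertOld f nothing z = inject₁ (f z)
insertOld {n} f (just y) z with f z ≟ᶠ y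
... | yes _ = fromℕ n
... | no _ = inject₁ (f z)

insertNew : {n : ℕ} (f : Fin n → Fin n) → Maybe (Fin n) → Fin (suc n)
insertNew {n} f nothing = fromℕ n
insertNew f (just y) = inject₁ y

insertView : {n : ℕ} (f : Fin n → Fin n) (p : Maybe (Fin n)) {i : Fin (suc n)} → View i → Fin (suc n)
insertView f p (old z) = insertOld f p z
insertView f p new = insertNew f p

insertAt : {n : ℕ} (f : Fin n → Fin n) (p : Maybe (Fin n)) → Fin (suc n) → Fin (suc n)
insertAt f p i = insertView f p (view i)

insertAt-inject₁ : {n : ℕ} (f : Fin n → Fin n) (p : Maybe (Fin n)) (z : Fin n) → insertAt f p (inject₁ z) ≡ insertOld f p z
insertAt-inject₁ f p z rewrite view-inject₁ z = refl

insertAt-fromℕ : {n : ℕ} (f : Fin n → Fin n) (p : Maybe (Fin n)) → insertAt f p (fromℕ n) ≡ insertNew f p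
insertAt-fromℕ {n} f p rewrite view-fromℕ n = refl

lower : {n : ℕ} → Fin n → {i : Fin (suc n)} → View i → Fin n
lower d (old w) = w
lower d new = d

delete : {n : ℕ} (g : Fin (suc n) → Fin (suc n)) → Fin n → Fin n
delete {n} g z = lower (lower z (view (g (fromℕ n)))) (view (g (inject₁ z)))

slotView : {n : ℕ} {i : Fin (suc n)} → View i → Maybe (Fin n)
slotView (old w) = just w
slotView new = nothing

slot : {n : ℕ} (g : Fin (suc n) → Fin (suc n)) → Maybe (Fin n)
slot {n} g = slotView (view (g (fromℕ n)))

lower-inject₁ : {n : ℕ} (d w : Fin n) → lower d (view (inject₁ w)) ≡ w
lower-inject₁ d w rewrite view-inject₁ w = refl

lower-fromℕ : {n : ℕ} (d : Fin n) → lower d (view (fromℕ n)) ≡ d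
lower-fromℕ {n} d rewrite view-fromℕ n = refl

insertOld-hit : {n : ℕ} (f : Fin n → Fin n) (y z : Fin n) → f z ≡ y → insertOld f (just y) z ≡ fromℕ n
insertOld-hit f y z e with f z ≟ᶠ y
... | yes _ = refl
... | no ne = ⊥-elim (ne e)

insertOld-miss : {n : ℕ} (f : Fin n → Fin n) (y z : Fin n) → f z ≢ y → insertOld f (just y) z ≡ inject₁ (f z)
insertOld-miss f y z ne with f z ≟ᶠ y
... | yes e = ⊥-elim (ne e)
... | no _ = refl

delete-insertAt : {n : ℕ} (f : Fin n → Fin n) (p : Maybe (Fin n)) (z : Fin n) → delete (insertAt f p) z ≡ f z
delete-insertAt {n} f nothing z rewrite insertAt-inject₁ f nothing z = lower-inject₁ _ (f z)
delete-insertAt {n} f (just y) z with f z ≟ᶠ y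
... | yes e rewrite insertAt-inject₁ f (just y) z | insertOld-hit f y z e | insertAt-fromℕ f (just y) =
      trans (lower-fromℕ _) (trans (lower-inject₁ z y) (sym e))
... | no ne rewrite insertAt-inject₁ f (just y) z | insertOld-miss f y z ne = lower-inject₁ _ (f z)

slot-insertAt : {n : ℕ} (f : Fin n → Fin n) (p : Maybe (Fin n)) → slot (insertAt f p) ≡ p
slot-insertAt {n} f nothing rewrite insertAt-fromℕ f nothing | view-fromℕ n = refl
slot-insertAt {n} f (just y) rewrite insertAt-fromℕ f (just y) | view-inject₁ y = refl

insertOld≢insertNew : {n : ℕ} (f : Fin n → Fin n) (p : Maybe (Fin n)) (z : Fin n) → insertOld f p z ≢ insertNew f p
insertOld≢insertNew f nothing z h = fromℕ≢inject₁ (sym h)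
insertOld≢insertNew f (just y) z h with f z ≟ᶠ y
... | yes _ = fromℕ≢inject₁ h
... | no fz≢y = fz≢y (inject₁-injective h)

insertOld-injective : {n : ℕ} (f : Fin n → Fin n) (p : Maybe (Fin n)) → Inj f → Inj (insertOld f p)
insertOld-injective f nothing inj h = inj (inject₁-injective h)
insertOld-injective f (just y) inj {z} {z'} h with f z ≟ᶠ y | f z' ≟ᶠ y
... | yes fz≡y | yes fz'≡y = inj (trans fz≡y (sym fz'≡y))
... | yes _ | no _ = ⊥-elim (fromℕ≢inject₁ h)
... | no _ | yes _ = ⊥-elim (fromℕ≢inject₁ (sym h))
... | no _ | no _ = inj (inject₁-injective h)

insertAt-injective : {n : ℕ} (f : Fin n → Fin n) (p : Maybe (Fin n)) → Inj f → Inj (insertAt f p)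
insertAt-injective f p inj {i} {j} = go (view i) (view j)
  where
  go : ∀ {i j} → View i → View j → insertAt f p i ≡ insertAt f p j → i ≡ j
  go (old z) (old z') e = cong inject₁ (insertOld-injective f p inj (trans (sym (insertAt-inject₁ f p z)) (trans e (insertAt-inject₁ f p z'))))
  go (old z) new e = ⊥-elim (insertOld≢insertNew f p z (trans (sym (insertAt-inject₁ f p z)) (trans e (insertAt-fromℕ f p))))
  go new (old z) e = ⊥-elim (insertOld≢insertNew f p z (trans (sym (insertAt-inject₁ f p z)) (trans (sym e) (insertAt-fromℕ f p))))
  go new new _ = refl

data OldCase {n : ℕ} (g : Fin (suc n) → Fin (suc n)) (z : Fin n) : Set where
  toOld : (w : Fin n) → g (inject₁ z) ≡ inject₁ w → OldCase g z
  toNew : g (inject₁ z) ≡ fromℕ n → OldCase g z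

oldCase : {n : ℕ} (g : Fin (suc n) → Fin (suc n)) (z : Fin n) → OldCase g z
oldCase {n} g z = go (view (g (inject₁ z))) refl where
  go : ∀ {i} → View i → g (inject₁ z) ≡ i → OldCase g z
  go (old w) e = toOld w e
  go new e = toNew e

data NewCase {n : ℕ} (g : Fin (suc n) → Fin (suc n)) : Set where
  nOld : (w : Fin n) → g (fromℕ n) ≡ inject₁ w → NewCase g
  nNew : g (fromℕ n) ≡ fromℕ n → NewCase g

newCase : {n : ℕ} (g : Fin (suc n) → Fin (suc n)) → NewCase g
newCase {n} g = go (view (g (fromℕ n))) refl where
  go : ∀ {i} → View i → g (fromℕ n) ≡ i → NewCase g
  go (old w) e = nOld w e
  go new e = nNew e

delete-old : {n : ℕ} (g : Fin (suc n) → Fin (suc n)) (z w : Fin n) → g (inject₁ z) ≡ inject₁ w → delete g z ≡ w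
delete-old {n} g z w e = trans (cong (lower (lower z (view (g (fromℕ n)))) ∘ view) e) (lower-inject₁ _ w)

delete-new : {n : ℕ} (g : Fin (suc n) → Fin (suc n)) (z w : Fin n) → g (inject₁ z) ≡ fromℕ _ → g (fromℕ _) ≡ inject₁ w → delete g z ≡ w
delete-new {n} g z w e e' = trans (cong (lower (lower z (view (g (fromℕ n)))) ∘ view) e) (trans (lower-fromℕ _) (trans (cong (lower z ∘ view) e') (lower-inject₁ z w)))

delete-injective : {n : ℕ} (g : Fin (suc n) → Fin (suc n)) → Inj g → Inj (delete g)
delete-injective {n} g inj {z} {z'} e with oldCase g z | oldCase g z'
... | toOld w a | toOld w' b = inject₁-injective (inj (trans a (trans (cong inject₁ (trans (sym (delete-old g z w a)) (trans e (delete-old g z' w' b)))) (sym b))))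
... | toNew a | toNew b = inject₁-injective (inj (trans a (sym b)))
... | toOld w a | toNew b with newCase g
...   | nNew c = ⊥-elim (fromℕ≢inject₁ (inj (trans c (sym b))))
...   | nOld u c = ⊥-elim (fromℕ≢inject₁ (sym (inj (trans a (trans (cong inject₁ (trans (sym (delete-old g z w a)) (trans e (delete-new g z' u b c)))) (sym c))))))
delete-injective {n} g inj {z} {z'} e | toNew a | toOld w' b with newCase g
...   | nNew c = ⊥-elim (fromℕ≢inject₁ (inj (trans c (sym a))))
...   | nOld u c = ⊥-elim (fromℕ≢inject₁ (inj (trans c (trans (cong inject₁ (trans (sym (delete-new g z u a c)) (trans e (delete-old g z' w' b)))) (sym b)))))

slot-cong : {n : ℕ} (g g' : Fin (suc n) → Fin (suc n)) → g (fromℕ n) ≡ g' (fromℕ n) → slot g ≡ slot g'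
slot-cong g g' e = cong (slotView ∘ view) e

delete-cong : {n : ℕ} (g g' : Fin (suc n) → Fin (suc n)) → (∀ i → g i ≡ g' i) → ∀ z → delete g z ≡ delete g' z
delete-cong {n} g g' e z = cong₂ (λ a b → lower (lower z (view a)) (view b)) (e (fromℕ n)) (e (inject₁ z))

insertAt-slot-delete : {n : ℕ} (g : Fin (suc n) → Fin (suc n)) → Inj g → (f : Fin n → Fin n) → (∀ z → f z ≡ delete g z) →
  ∀ i → insertAt f (slot g) i ≡ g i
insertAt-slot-delete {n} g inj f σ≡delete i = go (view i) refl
  where
  slot-new : g (fromℕ n) ≡ fromℕ n → slot g ≡ nothing
  slot-new c = trans (cong (slotView ∘ view) c) (cong slotView (view-fromℕ n))
  slot-old : ∀ u → g (fromℕ n) ≡ inject₁ u → slot g ≡ just u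
  slot-old u c = trans (cong (slotView ∘ view) c) (cong slotView (view-inject₁ u))
  go : ∀ {i} (vi : View i) → view i ≡ vi → insertAt f (slot g) i ≡ g i
  go new _ with newCase g
  ... | nNew c rewrite insertAt-fromℕ f (slot g) | c | view-fromℕ n = refl
  ... | nOld u c rewrite insertAt-fromℕ f (slot g) | c | view-inject₁ u = refl
  go (old z) _ with newCase g | oldCase g z
  ... | nNew c | toOld w a rewrite slot-new c | insertAt-inject₁ f nothing z = trans (cong inject₁ (trans (σ≡delete z) (delete-old g z w a))) (sym a)
  ... | nNew c | toNew a = ⊥-elim (fromℕ≢inject₁ (inj (trans c (sym a))))
  ... | nOld u c | toOld w a rewrite slot-old u c | insertAt-inject₁ f (just u) z =
        trans (insertOld-miss f u z ne) (trans (cong inject₁ (trans (σ≡delete z) (delete-old g z w a))) (sym a))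
    where
    ne : f z ≢ u
    ne e = fromℕ≢inject₁ (sym (inj (trans a (trans (cong inject₁ (trans (sym (delete-old g z w a)) (trans (sym (σ≡delete z)) e))) (sym c)))))
  ... | nOld u c | toNew a rewrite slot-old u c | insertAt-inject₁ f (just u) z =
        trans (insertOld-hit f u z (trans (σ≡delete z) (delete-new g z u a c))) (sym a)

insertV : {n : ℕ} → Vec (Fin n) n → Maybe (Fin n) → Vec (Fin (suc n)) (suc n)
insertV σ p = vtab (insertAt (lookup σ) p)

deleteV : {n : ℕ} → Vec (Fin (suc n)) (suc n) → Vec (Fin n) n
deleteV π = vtab (delete (lookup π))

slots : (n : ℕ) → List (Maybe (Fin n))
slots n = nothing ∷ map just (allFin n)

∈-slots : {n : ℕ} (p : Maybe (Fin n)) → p ∈ slots n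
∈-slots nothing = here refl
∈-slots (just y) = there (∈-map⁺ just (∈-allFin y))

Unique-slots : (n : ℕ) → Unique (slots n)
Unique-slots n = Unique-cons nothing∉ (map⁺ (λ { refl → refl }) (allFin⁺ n))
  where
  nothing∉ : nothing ∉ map just (allFin n)
  nothing∉ m with ∈-map⁻ just m
  ... | _ , _ , ()

insertions : (n : ℕ) → List (Vec (Fin (suc n)) (suc n))
insertions n = concatMap (λ σ → map (insertV σ) (slots n)) (Sym n)

lookup-insertV : {n : ℕ} (σ : Vec (Fin n) n) (p : Maybe (Fin n)) (i : Fin (suc n)) → lookup (insertV σ p) i ≡ insertAt (lookup σ) p i
lookup-insertV σ p i = lookup∘tabulate (insertAt (lookup σ) p) i

insertV-injectiveʳ : {n : ℕ} (σ : Vec (Fin n) n) {p p' : Maybe (Fin n)} → insertV σ p ≡ insertV σ p' → p ≡ p'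
insertV-injectiveʳ {n} σ {p} {p'} e = trans (sym (slot-insertAt (lookup σ) p)) (trans (slot-cong (insertAt (lookup σ) p) (insertAt (lookup σ) p') h) (slot-insertAt (lookup σ) p'))
  where
  h : insertAt (lookup σ) p (fromℕ n) ≡ insertAt (lookup σ) p' (fromℕ n)
  h = trans (sym (lookup-insertV σ p (fromℕ n))) (trans (cong (λ v → lookup v (fromℕ n)) e) (lookup-insertV σ p' (fromℕ n)))

insertV-injectiveˡ : {n : ℕ} (σ σ' : Vec (Fin n) n) {p p' : Maybe (Fin n)} → insertV σ p ≡ insertV σ' p' → σ ≡ σ'
insertV-injectiveˡ {n} σ σ' {p} {p'} e = lookup-ext σ σ' λ z →
  trans (sym (delete-insertAt (lookup σ) p z)) (trans (delete-cong (insertAt (lookup σ) p) (insertAt (lookup σ') p') same z) (delete-insertAt (lookup σ') p' z))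
  where
  same : ∀ i → insertAt (lookup σ) p i ≡ insertAt (lookup σ') p' i
  same i = trans (sym (lookup-insertV σ p i)) (trans (cong (λ v → lookup v i) e) (lookup-insertV σ' p' i))

Unique-insertions : (n : ℕ) → Unique (insertions n)
Unique-insertions n = Unique-concatMap _ (Sym n) (Unique-Sym n) (λ σ _ → map⁺ (insertV-injectiveʳ σ) (Unique-slots n)) d
  where
  d : ∀ σ σ' a → σ ∈ Sym n → σ' ∈ Sym n → a ∈ map (insertV σ) (slots n) → a ∈ map (insertV σ') (slots n) → σ ≡ σ'
  d σ σ' a _ _ ma mb with ∈-map⁻ (insertV σ) ma | ∈-map⁻ (insertV σ') mb
  ... | p , _ , refl | p' , _ , e = insertV-injectiveˡ σ σ' e

insertions⊆Sym : (n : ℕ) (π : Vec (Fin (suc n)) (suc n)) → π ∈ insertions n → π ∈ Sym (suc n)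
insertions⊆Sym n π m with ∈-concatMap-elim _ (Sym n) m
... | σ , mσ , mπ with ∈-map⁻ (insertV σ) mπ
... | p , _ , refl = Inj⇒∈-Sym (insertV σ p) (λ {i} {j} e → insertAt-injective (lookup σ) p (Sym⇒Inj σ mσ) (trans (sym (lookup-insertV σ p i)) (trans e (lookup-insertV σ p j))))

Sym⊆insertions : (n : ℕ) (π : Vec (Fin (suc n)) (suc n)) → π ∈ Sym (suc n) → π ∈ insertions n
Sym⊆insertions n π m = subst (_∈ insertions n) insertV≡π (∈-concatMap-intro (λ σ → map (insertV σ) (slots n)) σ∈ (∈-map⁺ (insertV σ) (∈-slots p)))
  where
  g = lookup π
  ginj = Sym⇒Inj π m
  σ = deleteV π
  p = slot g
  σ≡delete : ∀ z → lookup σ z ≡ delete g z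
  σ≡delete z = lookup∘tabulate _ z
  σ∈ : σ ∈ Sym n
  σ∈ = Inj⇒∈-Sym σ (λ {i} {j} e → delete-injective g ginj (trans (sym (σ≡delete i)) (trans e (σ≡delete j))))
  insertV≡π : insertV σ p ≡ π
  insertV≡π = lookup-ext _ _ (λ i → trans (lookup-insertV σ p i) (insertAt-slot-delete g ginj (lookup σ) σ≡delete i))

∑-Sym-suc : (n : ℕ) (h : Vec (Fin (suc n)) (suc n) → ℕ) →
  ∑ h (Sym (suc n)) ≡ ∑ (λ σ → ∑ (λ p → h (insertV σ p)) (slots n)) (Sym n)
∑-Sym-suc n h = trans (∑-sameElements h (Sym (suc n)) (insertions n) (Unique-Sym (suc n)) (Unique-insertions n) (Sym⊆insertions n) (insertions⊆Sym n))
  (trans (∑-concatMap h _ (Sym n)) (∑-cong (Sym n) (λ σ _ → ∑-map h (insertV σ) (slots n))))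

iter : {n : ℕ} (f : Fin n → Fin n) → ℕ → Fin n → Fin n
iter f zero z = z
iter f (suc k) z = iter f k (f z)

iter-+ : {n : ℕ} (f : Fin n → Fin n) (a b : ℕ) (z : Fin n) → iter f (a + b) z ≡ iter f b (iter f a z)
iter-+ f zero b z = refl
iter-+ f (suc a) b z = iter-+ f a b (f z)

iter-suc : {n : ℕ} (f : Fin n → Fin n) (k : ℕ) (z : Fin n) → iter f (suc k) z ≡ f (iter f k z)
iter-suc f zero z = refl
iter-suc f (suc k) z = iter-suc f k (f z)

iter-comm : {n : ℕ} (f : Fin n → Fin n) (a b : ℕ) (z : Fin n) → iter f a (iter f b z) ≡ iter f b (iter f a z)
iter-comm f a b z = trans (sym (iter-+ f b a z)) (trans (cong (λ k → iter f k z) (+-comm b a)) (iter-+ f a b z))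

iter-inj : {n : ℕ} (f : Fin n → Fin n) → Inj f → ∀ k {a b} → iter f k a ≡ iter f k b → a ≡ b
iter-inj f inj zero e = e
iter-inj f inj (suc k) e = inj (iter-inj f inj k e)

lt-split : ∀ {i j} → i < j → ∃[ d ] (j ≡ i + suc d)
lt-split {zero} {suc j} _ = j , refl
lt-split {suc i} {suc j} (s≤s l) with lt-split l
... | d , e = d , cong suc e

le-split : ∀ {i j} → i ≤ j → ∃[ d ] (j ≡ i + d)
le-split {zero} {j} _ = j , refl
le-split {suc i} {suc j} (s≤s l) with le-split l
... | d , e = d , cong suc e

minimize : (P : ℕ → Set) → (∀ q → Dec (P q)) → ∀ d m → P (m + d) → (∀ q → q < m → ¬ P q) →
  ∃[ p ] (P p × p ≤ m + d × (∀ q → q < p → ¬ P q))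
minimize P P? zero m h lo = m , subst P (+-identityʳ m) h , m≤m+n m 0 , lo
minimize P P? (suc d) m h lo with P? m
... | yes pm = m , pm , m≤m+n m (suc d) , lo
... | no npm with minimize P P? d (suc m) (subst P (+-suc m d) h) lo'
  where
  lo' : ∀ q → q < suc m → ¬ P q
  lo' q (s≤s q≤m) with m≤n⇒m<n∨m≡n q≤m
  ... | inj₁ q<m = lo q q<m
  ... | inj₂ refl = npm
... | p , pp , le , lo'' = p , pp , subst (p ≤_) (sym (+-suc m d)) le , lo''

data Path {n : ℕ} (f : Fin n → Fin n) (s : Fin n) : Fin n → List (Fin n) → Set where
  stop : ∀ {z} → f z ≡ s → Path f s z (z ∷ [])
  step : ∀ {z L} → f z ≢ s → Path f s (f z) L → Path f s z (z ∷ L)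

orbitFrom-Path : {n : ℕ} (f : Fin n → Fin n) {s z : Fin n} {L : List (Fin n)} → Path f s z L → ∀ k → length L ≤ k → orbitFrom f k s z ≡ L
orbitFrom-Path f {s} {z} (stop e) (suc k) le with f z ≟ᶠ s
... | yes _ = refl
... | no ne = ⊥-elim (ne e)
orbitFrom-Path f {s} {z} (step ne P) (suc k) (s≤s le) with f z ≟ᶠ s
... | yes e = ⊥-elim (ne e)
... | no _ = cong (z ∷_) (orbitFrom-Path f P k le)

iterList : {n : ℕ} (f : Fin n → Fin n) → Fin n → ℕ → List (Fin n)
iterList f z zero = z ∷ []
iterList f z (suc c) = z ∷ iterList f (f z) c

length-iterList : {n : ℕ} (f : Fin n → Fin n) (z : Fin n) (c : ℕ) → length (iterList f z c) ≡ suc c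
length-iterList f z zero = refl
length-iterList f z (suc c) = cong suc (length-iterList f (f z) c)

∈-iterList⁻ : {n : ℕ} (f : Fin n → Fin n) (z : Fin n) (c : ℕ) {w : Fin n} → w ∈ iterList f z c → ∃[ i ] (i ≤ c × w ≡ iter f i z)
∈-iterList⁻ f z zero (here e) = 0 , z≤n , e
∈-iterList⁻ f z (suc c) (here e) = 0 , z≤n , e
∈-iterList⁻ f z (suc c) (there m) with ∈-iterList⁻ f (f z) c m
... | i , le , e = suc i , s≤s le , e

∈-iterList⁺ : {n : ℕ} (f : Fin n → Fin n) (z : Fin n) (c i : ℕ) → i ≤ c → iter f i z ∈ iterList f z c
∈-iterList⁺ f z c zero _ with c
... | zero = here refl
... | suc _ = here refl
∈-iterList⁺ f z (suc c) (suc i) (s≤s le) = there (∈-iterList⁺ f (f z) c i le)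

-- The least period of y under f is suc per.
record Period {n : ℕ} (f : Fin n → Fin n) (y : Fin n) : Set where
  field
    per : ℕ
    per-ret : iter f (suc per) y ≡ y
    per-le : suc per ≤ n
    per-min : ∀ q → q < per → iter f (suc q) y ≢ y

period : {n : ℕ} (f : Fin n → Fin n) → Inj f → (y : Fin n) → Period f y
period {n} f inj y with pigeonhole (n<1+n n) (λ (i : Fin (suc n)) → iter f (toℕ i) y)
... | i , j , i<j , e with lt-split i<j
... | d , jeq with minimize (λ q → iter f (suc q) y ≡ y) (λ q → iter f (suc q) y ≟ᶠ y) d 0 ret (λ q ())
  where
  ret : iter f (suc d) y ≡ y
  ret = sym (iter-inj f inj (toℕ i) (trans e (trans (cong (λ k → iter f k y) jeq) (trans (cong (λ k → iter f k y) (+-comm (toℕ i) (suc d))) (iter-+ f (suc d) (toℕ i) y)))))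
... | p , pp , le , lo = record { per = p ; per-ret = pp ; per-le = ≤-trans (s≤s le) (≤-trans (m≤n+m (suc d) (toℕ i)) (subst (_≤ n) jeq (≤-pred (toℕ<n j)))) ; per-min = lo }

<ᵇ-true⇒< : ∀ a b → (a <ᵇ b) ≡ true → a < b
<ᵇ-true⇒< zero (suc b) _ = s≤s z≤n
<ᵇ-true⇒< (suc a) (suc b) e = s≤s (<ᵇ-true⇒< a b e)

<ᵇ-false⇒≤ : ∀ a b → (a <ᵇ b) ≡ false → b ≤ a
<ᵇ-false⇒≤ a zero _ = z≤n
<ᵇ-false⇒≤ zero (suc b) ()
<ᵇ-false⇒≤ (suc a) (suc b) e = s≤s (<ᵇ-false⇒≤ a b e)

<⇒<ᵇ-true : ∀ {a b} → a < b → (a <ᵇ b) ≡ true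
<⇒<ᵇ-true {zero} {suc b} _ = refl
<⇒<ᵇ-true {suc a} {suc b} (s≤s l) = <⇒<ᵇ-true l

≤⇒<ᵇ-false : ∀ {a b} → b ≤ a → (a <ᵇ b) ≡ false
≤⇒<ᵇ-false {a} {zero} _ = refl
≤⇒<ᵇ-false {suc a} {suc b} (s≤s l) = ≤⇒<ᵇ-false {a} {b} l

not-<ᵇ⇒≤ : ∀ a b → not (a <ᵇ b) ≡ true → b ≤ a
not-<ᵇ⇒≤ a b e with a <ᵇ b in eq
... | false = <ᵇ-false⇒≤ a b eq
not-<ᵇ⇒≤ a b () | true

≤⇒not-<ᵇ : ∀ {a b} → b ≤ a → not (a <ᵇ b) ≡ true
≤⇒not-<ᵇ {a} {b} l rewrite ≤⇒<ᵇ-false {a} {b} l = refl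

minimumᶠ : {n : ℕ} → Fin n → List (Fin n) → Fin n
minimumᶠ a [] = a
minimumᶠ a (b ∷ L) = minimumᶠ (if toℕ b <ᵇ toℕ a then b else a) L

minimumᶠ-∈ : {n : ℕ} (a : Fin n) (L : List (Fin n)) → minimumᶠ a L ∈ a ∷ L
minimumᶠ-∈ a [] = here refl
minimumᶠ-∈ a (b ∷ L) with toℕ b <ᵇ toℕ a
... | true with minimumᶠ-∈ b L
...   | here e = there (here e)
...   | there m = there (there m)
minimumᶠ-∈ a (b ∷ L) | false with minimumᶠ-∈ a L
...   | here e = here e
...   | there m = there (there m)

minimumᶠ-≤ : {n : ℕ} (a : Fin n) (L : List (Fin n)) → ∀ w → w ∈ a ∷ L → toℕ (minimumᶠ a L) ≤ toℕ w
minimumᶠ-≤ a [] w (here refl) = ≤-refl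
minimumᶠ-≤ a (b ∷ L) w m with toℕ b <ᵇ toℕ a in eq
minimumᶠ-≤ a (b ∷ L) w (here refl) | true = ≤-trans (minimumᶠ-≤ b L b (here refl)) (<⇒≤ (<ᵇ-true⇒< _ _ eq))
minimumᶠ-≤ a (b ∷ L) w (there (here refl)) | true = minimumᶠ-≤ b L b (here refl)
minimumᶠ-≤ a (b ∷ L) w (there (there m)) | true = minimumᶠ-≤ b L w (there m)
minimumᶠ-≤ a (b ∷ L) w (here refl) | false = minimumᶠ-≤ a L a (here refl)
minimumᶠ-≤ a (b ∷ L) w (there (here refl)) | false = ≤-trans (minimumᶠ-≤ a L a (here refl)) (<ᵇ-false⇒≤ _ _ eq)
minimumᶠ-≤ a (b ∷ L) w (there (there m)) | false = minimumᶠ-≤ a L w (there m)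

module Orbits {n : ℕ} (f : Fin n → Fin n) (inj : Inj f) where

  periodOf : (y : Fin n) → Period f y
  periodOf y = period f inj y

  per : Fin n → ℕ
  per y = Period.per (periodOf y)

  orbit : Fin n → List (Fin n)
  orbit y = iterList f y (per y)

  orbit-head : ∀ y → ∃[ L ] (orbit y ≡ y ∷ L)
  orbit-head y with per y
  ... | zero = [] , refl
  ... | suc c = iterList f (f y) c , refl

  iterList-Path : ∀ y c a → a + c ≡ per y → Path f y (iter f a y) (iterList f (iter f a y) c)
  iterList-Path y zero a e = stop (trans (sym (iter-suc f a y)) (subst (λ k → iter f (suc k) y ≡ y) (sym (trans (sym (+-identityʳ a)) e)) (Period.per-ret (periodOf y))))
  iterList-Path y (suc c) a e = step ne (subst (λ w → Path f y w (iterList f w c)) (iter-suc f a y) (iterList-Path y c (suc a) (trans (sym (+-suc a c)) e)))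
    where
    ne : f (iter f a y) ≢ y
    ne h = Period.per-min (periodOf y) a (subst (a <_) e (m<m+n a (s≤s z≤n))) (trans (iter-suc f a y) h)

  Path-orbit : ∀ y → Path f y y (orbit y)
  Path-orbit y = iterList-Path y (per y) 0 refl

  length-orbit : ∀ y → length (orbit y) ≤ n
  length-orbit y = subst (_≤ n) (sym (length-iterList f y (per y))) (Period.per-le (periodOf y))

  Unique-iterList : ∀ y c a → a + c ≤ per y → Unique (iterList f (iter f a y) c)
  Unique-iterList y zero a le = [] ∷ []
  Unique-iterList y (suc c) a le = Unique-cons nm (subst (λ w → Unique (iterList f w c)) (iter-suc f a y) (Unique-iterList y c (suc a) (subst (_≤ per y) (+-suc a c) le)))
    where
    nm : iter f a y ∉ iterList f (f (iter f a y)) c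
    nm m with ∈-iterList⁻ f (f (iter f a y)) c m
    ... | i , i≤c , e = Period.per-min (periodOf y) i i<p (sym (iter-inj f inj a (trans e (iter-comm f (suc i) a y))))
      where
      i<p : i < per y
      i<p = ≤-trans (s≤s i≤c) (≤-trans (m≤n+m (suc c) a) le)

  Unique-orbit : ∀ y → Unique (orbit y)
  Unique-orbit y = Unique-iterList y (per y) 0 ≤-refl

  ∈-orbit-iter′ : ∀ y fuel k → k ≤ fuel → iter f k y ∈ orbit y
  ∈-orbit-iter′ y fuel k le with k ≤? per y
  ... | yes kp = ∈-iterList⁺ f y (per y) k kp
  ∈-orbit-iter′ y (suc fuel) k le | no kp with le-split (≰⇒> kp)
  ... | k' , keq = subst (_∈ orbit y) (sym e) (∈-orbit-iter′ y fuel k' (≤-pred (≤-trans (s≤s (m≤n+m k' (per y))) (subst (_≤ suc fuel) keq le))))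
    where
    e : iter f k y ≡ iter f k' y
    e = trans (cong (λ j → iter f j y) keq) (trans (iter-+ f (suc (per y)) k' y) (cong (iter f k') (Period.per-ret (periodOf y))))
  ∈-orbit-iter′ y zero k le | no kp = ⊥-elim (kp (≤-trans le z≤n))

  ∈-orbit-iter : ∀ y k → iter f k y ∈ orbit y
  ∈-orbit-iter y k = ∈-orbit-iter′ y k k ≤-refl

  ∈-orbit⇒iter : ∀ y {w} → w ∈ orbit y → ∃[ i ] (w ≡ iter f i y)
  ∈-orbit⇒iter y m with ∈-iterList⁻ f y (per y) m
  ... | i , _ , e = i , e

  iter-return : ∀ y i → ∃[ j ] (iter f j (iter f i y) ≡ y)
  iter-return y i with ∈-iterList⁻ f y (per y) (∈-orbit-iter y i)
  ... | i' , le , e with le-split (m≤n⇒m≤1+n le)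
  ... | d , deq = d , trans (cong (iter f d) e) (trans (sym (iter-+ f i' d y)) (trans (cong (λ k → iter f k y) (sym deq)) (Period.per-ret (periodOf y))))

  orbit-sym : ∀ y {z} → z ∈ orbit y → y ∈ orbit z
  orbit-sym y {z} m with ∈-orbit⇒iter y m
  ... | i , refl with iter-return y i
  ... | j , e = subst (_∈ orbit (iter f i y)) e (∈-orbit-iter (iter f i y) j)

  orbit-trans : ∀ y {z w} → z ∈ orbit y → w ∈ orbit z → w ∈ orbit y
  orbit-trans y m1 m2 with ∈-orbit⇒iter y m1
  ... | i , refl with ∈-orbit⇒iter (iter f i y) m2
  ... | j , refl = subst (_∈ orbit y) (iter-+ f i j y) (∈-orbit-iter y (i + j))

  ∈-orbit-self : ∀ y → y ∈ orbit y
  ∈-orbit-self y = ∈-orbit-iter y 0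

  fixed⇒period0 : ∀ y → f y ≡ y → per y ≡ 0
  fixed⇒period0 y e with per y in pe
  ... | zero = refl
  ... | suc q = ⊥-elim (Period.per-min (periodOf y) 0 (subst (0 <_) (sym pe) (s≤s z≤n)) e)

  period0⇒fixed : ∀ y → per y ≡ 0 → f y ≡ y
  period0⇒fixed y e = subst (λ k → iter f (suc k) y ≡ y) e (Period.per-ret (periodOf y))

  surj : ∀ y → ∃[ x ] (f x ≡ y)
  surj y = iter f (per y) y , trans (sym (iter-suc f (per y) y)) (Period.per-ret (periodOf y))

isCycleMin? : {n : ℕ} (σ : Vec (Fin n) n) (y : Fin n) → Dec (isCycleMin σ y ≡ true)
isCycleMin? σ y = isCycleMin σ y ≟ᵇ true

cyc≡∑ : {m : ℕ} (π : Vec (Fin m) m) → cyc π ≡ ∑ (𝟙 ∘ isCycleMin π) (allFin m)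
cyc≡∑ {m} π = trans (Data.List.Properties.length-map (cycleOf π) minima)
  (trans (length≡∑1 minima) (∑-filter (λ _ → 1) (isCycleMin π) (allFin m)))
  where minima = filter (isCycleMin? π) (allFin m)

cval≡∑ : {m : ℕ} (π : Vec (Fin m) m) → cval π ≡ ∑ (λ y → if isCycleMin π y then valleys (cycleOf π y) else 0) (allFin m)
cval≡∑ {m} π = trans (∑-map valleys (cycleOf π) minima) (∑-filter (valleys ∘ cycleOf π) (isCycleMin π) (allFin m))
  where minima = filter (isCycleMin? π) (allFin m)

fix≡∑ : {m : ℕ} (π : Vec (Fin m) m) → fix π ≡ ∑ (λ x → 𝟙 ⌊ lookup π x ≟ᶠ x ⌋) (allFin m)
fix≡∑ {m} π = countᵇ≡∑ _ (allFin m)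

toℕ-∉ : {n : ℕ} {z : Fin n} {L : List (Fin n)} → z ∉ L → toℕ z ∉ map toℕ L
toℕ-∉ {L = L} z∉L m with ∈-map⁻ toℕ m
... | w , w∈L , e = z∉L (subst (_∈ L) (sym (toℕ-injective e)) w∈L)

module Cycles {n : ℕ} (σ : Vec (Fin n) n) (inj : Inj (lookup σ)) where
  open Orbits (lookup σ) inj public

  cycleOf≡orbit : ∀ y → cycleOf σ y ≡ orbit y
  cycleOf≡orbit y = orbitFrom-Path (lookup σ) (Path-orbit y) n (length-orbit y)

  isMin : Fin n → Bool
  isMin y = isCycleMin σ y

  isMin-≤ : ∀ y → isMin y ≡ true → ∀ w → w ∈ orbit y → toℕ y ≤ toℕ w
  isMin-≤ y e w m = not-<ᵇ⇒≤ (toℕ w) (toℕ y) (allᵇ-elim _ (cycleOf σ y) e w (subst (w ∈_) (sym (cycleOf≡orbit y)) m))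

  isMin-intro : ∀ y → (∀ w → w ∈ orbit y → toℕ y ≤ toℕ w) → isMin y ≡ true
  isMin-intro y h = allᵇ-intro _ (cycleOf σ y) (λ w m → ≤⇒not-<ᵇ (h w (subst (w ∈_) (cycleOf≡orbit y) m)))

  isMin-unique : ∀ y y' a → isMin y ≡ true → isMin y' ≡ true → a ∈ orbit y → a ∈ orbit y' → y ≡ y'
  isMin-unique y y' a c c' m m' = toℕ-injective (≤-antisym
    (isMin-≤ y c y' (orbit-trans y m (orbit-sym y' m')))
    (isMin-≤ y' c' y (orbit-trans y' m' (orbit-sym y m))))

  isMin-exists : ∀ z → ∃[ m ] (isMin m ≡ true × z ∈ orbit m)
  isMin-exists z with orbit-head z
  ... | L , e = m , isMin-intro m le , orbit-sym z m∈
    where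
    m = minimumᶠ z L
    m∈ : m ∈ orbit z
    m∈ = subst (m ∈_) (sym e) (minimumᶠ-∈ z L)
    le : ∀ w → w ∈ orbit m → toℕ m ≤ toℕ w
    le w mw = minimumᶠ-≤ z L w (subst (w ∈_) e (orbit-trans z m∈ mw))

  ∑-by-cycles : (h : Fin n → ℕ) → ∑ h (allFin n) ≡ ∑ (λ y → if isMin y then ∑ h (orbit y) else 0) (allFin n)
  ∑-by-cycles h = trans (∑-sameElements h (allFin n) (concatMap orbit minima) (allFin⁺ n) unique (λ z _ → covers z) (λ z _ → ∈-allFin z))
                 (trans (∑-concatMap h orbit minima) (∑-filter (λ y → ∑ h (orbit y)) isMin (allFin n)))
    where
    minima = filter (isCycleMin? σ) (allFin n)
    minimal : ∀ {y} → y ∈ minima → isMin y ≡ true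
    minimal y∈ = proj₂ (∈-filter⁻ (isCycleMin? σ) {xs = allFin n} y∈)
    unique : Unique (concatMap orbit minima)
    unique = Unique-concatMap orbit _ (filter⁺ (isCycleMin? σ) (allFin⁺ n)) (λ y _ → Unique-orbit y)
      (λ y y′ a y∈ y′∈ a∈ a∈′ → isMin-unique y y′ a (minimal y∈) (minimal y′∈) a∈ a∈′)
    covers : ∀ z → z ∈ concatMap orbit minima
    covers z with isMin-exists z
    ... | m , m-min , z∈ = ∈-concatMap-intro orbit (∈-filter⁺ (isCycleMin? σ) {xs = allFin n} (∈-allFin m) m-min) z∈

  cval≡∑orbit : cval σ ≡ ∑ (λ y → if isMin y then valleys (orbit y) else 0) (allFin n)
  cval≡∑orbit = trans (cval≡∑ σ) (∑-cong (allFin n) (λ y _ → cong (λ L → if isMin y then valleys L else 0) (cycleOf≡orbit y)))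

valleysℕ : List ℕ → ℕ
valleysℕ (a ∷ b ∷ c ∷ r) = 𝟙 ((b <ᵇ a) ∧ (b <ᵇ c)) + valleysℕ (b ∷ c ∷ r)
valleysℕ _ = 0

insertAfter : ℕ → ℕ → List ℕ → List ℕ
insertAfter a B [] = []
insertAfter a B (w ∷ L) = if w ≡ᵇ a then w ∷ B ∷ L else w ∷ insertAfter a B L

-- Inserting a letter B larger than all entries right after w (preceded by pr, followed by L)
-- destroys no valley; it creates one at w (gainLeft) or at the entry following w (gainRight).
gainLeft : Maybe ℕ → ℕ → List ℕ → ℕ
gainLeft nothing w L = 0
gainLeft (just u) w [] = 𝟙 (w <ᵇ u)
gainLeft (just u) w (c ∷ L) = 𝟙 ((w <ᵇ u) ∧ not (w <ᵇ c))

gainRight : ℕ → List ℕ → ℕ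
gainRight w (c ∷ d ∷ r) = 𝟙 ((c <ᵇ d) ∧ not (c <ᵇ w))
gainRight w _ = 0

gain : Maybe ℕ → ℕ → List ℕ → ℕ
gain pr w L = gainLeft pr w L + gainRight w L

gainAt : Maybe ℕ → ℕ → List ℕ → ℕ
gainAt pr a [] = 0
gainAt pr a (w ∷ L) = if w ≡ᵇ a then gain pr w L else gainAt (just w) a L

insertAfter-head : ∀ a B c L → ∃[ Y ] (insertAfter a B (c ∷ L) ≡ c ∷ Y)
insertAfter-head a B c L with c ≡ᵇ a
... | true = B ∷ L , refl
... | false = insertAfter a B L , refl

𝟙-∧-split : ∀ p q → 𝟙 (p ∧ q) + 𝟙 (p ∧ not q) ≡ 𝟙 p
𝟙-∧-split true true = refl
𝟙-∧-split true false = refl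
𝟙-∧-split false q = refl

𝟙-∧-split′ : ∀ p q → 𝟙 (q ∧ p) + 𝟙 (p ∧ not q) ≡ 𝟙 p
𝟙-∧-split′ p q = trans (cong (λ b → 𝟙 b + 𝟙 (p ∧ not q)) (∧-comm q p)) (𝟙-∧-split p q)

valleysℕ-insertAfter-∷ : ∀ a B u L → All (_< B) L → valleysℕ (u ∷ insertAfter a B L) ≡ valleysℕ (u ∷ L) + gainAt (just u) a L
valleysℕ-insertAfter-∷ a B u [] _ = refl
valleysℕ-insertAfter-∷ a B u (w ∷ L) (w<B ∷ L<B) with w ≡ᵇ a
valleysℕ-insertAfter-∷ a B u (w ∷ []) (w<B ∷ _) | true rewrite <⇒<ᵇ-true w<B =
  trans (+-identityʳ _) (trans (cong 𝟙 (∧-identityʳ (w <ᵇ u))) (sym (+-identityʳ _)))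
valleysℕ-insertAfter-∷ a B u (w ∷ c ∷ []) (w<B ∷ _) | true rewrite <⇒<ᵇ-true w<B | ≤⇒<ᵇ-false (<⇒≤ w<B) =
  trans (+-identityʳ _) (trans (cong 𝟙 (∧-identityʳ (w <ᵇ u))) (trans (sym (𝟙-∧-split (w <ᵇ u) (w <ᵇ c)))
    (cong₂ _+_ (sym (+-identityʳ (𝟙 ((w <ᵇ u) ∧ (w <ᵇ c))))) (sym (+-identityʳ (𝟙 ((w <ᵇ u) ∧ not (w <ᵇ c))))))))
valleysℕ-insertAfter-∷ a B u (w ∷ c ∷ d ∷ r) (w<B ∷ c<B ∷ _) | true rewrite <⇒<ᵇ-true w<B | ≤⇒<ᵇ-false (<⇒≤ w<B) | <⇒<ᵇ-true c<B =
  begin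
    𝟙 (p ∧ true) + (0 + (𝟙 q′ + V)) ≡⟨ cong₂ (λ k l → k + (0 + (l + V))) (cong 𝟙 (∧-identityʳ p)) (sym (𝟙-∧-split′ q′ p′)) ⟩
    𝟙 p + (0 + ((𝟙 (p′ ∧ q′) + 𝟙 (q′ ∧ not p′)) + V)) ≡⟨ cong (λ k → k + (0 + ((𝟙 (p′ ∧ q′) + 𝟙 (q′ ∧ not p′)) + V))) (sym (𝟙-∧-split p q)) ⟩
    (𝟙 (p ∧ q) + 𝟙 (p ∧ not q)) + (0 + ((𝟙 (p′ ∧ q′) + 𝟙 (q′ ∧ not p′)) + V)) ≡⟨ regroup (𝟙 (p ∧ q)) (𝟙 (p ∧ not q)) (𝟙 (p′ ∧ q′)) (𝟙 (q′ ∧ not p′)) V ⟩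
    (𝟙 (p ∧ q) + (𝟙 (p′ ∧ q′) + V)) + (𝟙 (p ∧ not q) + 𝟙 (q′ ∧ not p′)) ∎
  where
  open ≡-Reasoning
  p = w <ᵇ u ; q = w <ᵇ c ; p′ = c <ᵇ w ; q′ = c <ᵇ d
  V = valleysℕ (c ∷ d ∷ r)
  regroup : ∀ a₁ a₂ b₁ b₂ v → (a₁ + a₂) + (0 + ((b₁ + b₂) + v)) ≡ (a₁ + (b₁ + v)) + (a₂ + b₂)
  regroup = solve-∀
valleysℕ-insertAfter-∷ a B u (w ∷ []) _ | false = refl
valleysℕ-insertAfter-∷ a B u (w ∷ c ∷ L) (_ ∷ L<B) | false with insertAfter-head a B c L | valleysℕ-insertAfter-∷ a B w (c ∷ L) L<B
... | Y , eqY | ih rewrite eqY = trans (cong (𝟙 ((w <ᵇ u) ∧ (w <ᵇ c)) +_) ih) (sym (+-assoc (𝟙 ((w <ᵇ u) ∧ (w <ᵇ c))) _ _))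

valleysℕ-insertAfter : ∀ a B L → All (_< B) L → valleysℕ (insertAfter a B L) ≡ valleysℕ L + gainAt nothing a L
valleysℕ-insertAfter a B [] _ = refl
valleysℕ-insertAfter a B (w ∷ L) (w<B ∷ L<B) with w ≡ᵇ a
valleysℕ-insertAfter a B (w ∷ []) _ | true = refl
valleysℕ-insertAfter a B (w ∷ c ∷ []) (w<B ∷ _) | true rewrite ≤⇒<ᵇ-false (<⇒≤ w<B) = refl
valleysℕ-insertAfter a B (w ∷ c ∷ d ∷ r) (w<B ∷ c<B ∷ _) | true rewrite ≤⇒<ᵇ-false (<⇒≤ w<B) | <⇒<ᵇ-true c<B =
  trans (cong (_+ V) (sym (𝟙-∧-split′ (c <ᵇ d) (c <ᵇ w)))) (regroup (𝟙 ((c <ᵇ w) ∧ (c <ᵇ d))) (𝟙 ((c <ᵇ d) ∧ not (c <ᵇ w))) V)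
  where
  V = valleysℕ (c ∷ d ∷ r)
  regroup : ∀ b₁ b₂ v → (b₁ + b₂) + v ≡ (b₁ + v) + (0 + b₂)
  regroup = solve-∀
valleysℕ-insertAfter a B (w ∷ L) (_ ∷ L<B) | false = valleysℕ-insertAfter-∷ a B w L L<B

gainSum : Maybe ℕ → List ℕ → ℕ
gainSum pr [] = 0
gainSum pr (w ∷ L) = gain pr w L + gainSum (just w) L

zeroGains : Maybe ℕ → List ℕ → ℕ
zeroGains pr [] = 0
zeroGains pr (w ∷ L) = 𝟙 (gain pr w L ≡ᵇ 0) + zeroGains (just w) L

<ᵇ-flip : ∀ w c → w ≢ c → (c <ᵇ w) ≡ not (w <ᵇ c)
<ᵇ-flip w c w≢c with w <ᵇ c in e₁ | c <ᵇ w in e₂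
... | true | true = ⊥-elim (<-asym (<ᵇ-true⇒< w c e₁) (<ᵇ-true⇒< c w e₂))
... | true | false = refl
... | false | true = refl
... | false | false = ⊥-elim (w≢c (≤-antisym (<ᵇ-false⇒≤ c w e₂) (<ᵇ-false⇒≤ w c e₁)))

-- The term that makes gain + 2 · valleys telescope along a list: 0 after a descent u > w, and
-- otherwise 1 plus whether the list continues upwards from w.
boundary : ℕ → ℕ → List ℕ → ℕ
boundary u w [] = if w <ᵇ u then 0 else 1
boundary u w (c ∷ _) = if w <ᵇ u then 0 else suc (𝟙 (w <ᵇ c))

gain-step : ∀ u w c L → w ≢ c →
  gain (just u) w (c ∷ L) + 2 * 𝟙 ((w <ᵇ u) ∧ (w <ᵇ c)) + boundary u w (c ∷ L) ≡ suc (boundary w c L)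
gain-step u w c [] w≢c rewrite <ᵇ-flip w c w≢c with w <ᵇ u | w <ᵇ c
... | true | true = refl
... | true | false = refl
... | false | true = refl
... | false | false = refl
gain-step u w c (d ∷ r) w≢c rewrite <ᵇ-flip w c w≢c with w <ᵇ u | w <ᵇ c | c <ᵇ d
... | true | true | true = refl
... | true | true | false = refl
... | true | false | true = refl
... | true | false | false = refl
... | false | true | true = refl
... | false | true | false = refl
... | false | false | true = refl
... | false | false | false = refl

gainSum-valleys : ∀ u w L → Linked _≢_ (w ∷ L) →
  gainSum (just u) (w ∷ L) + 2 * valleysℕ (u ∷ w ∷ L) + boundary u w L ≡ length (w ∷ L)
gainSum-valleys u w [] _ with w <ᵇ u
... | true = refl
... | false = refl
gainSum-valleys u w (c ∷ L) (w≢c ∷ distinct) = begin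
    G + X + 2 * (𝟙 ((w <ᵇ u) ∧ (w <ᵇ c)) + V) + boundary u w (c ∷ L)
      ≡⟨ regroup G X (𝟙 ((w <ᵇ u) ∧ (w <ᵇ c))) V (boundary u w (c ∷ L)) ⟩
    (G + 2 * 𝟙 ((w <ᵇ u) ∧ (w <ᵇ c)) + boundary u w (c ∷ L)) + (X + 2 * V)
      ≡⟨ cong (_+ (X + 2 * V)) (gain-step u w c L w≢c) ⟩
    suc (boundary w c L) + (X + 2 * V)
      ≡⟨ cong suc (trans (+-comm (boundary w c L) (X + 2 * V)) (gainSum-valleys w c L distinct)) ⟩
    length (w ∷ c ∷ L) ∎
  where
  open ≡-Reasoning
  G = gain (just u) w (c ∷ L)
  X = gainSum (just w) (c ∷ L)
  V = valleysℕ (w ∷ c ∷ L)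
  regroup : ∀ g x a v b → g + x + 2 * (a + v) + b ≡ (g + 2 * a + b) + (x + 2 * v)
  regroup = solve-∀

gain≤1 : ∀ pr w L → Linked _≢_ (w ∷ L) → gain pr w L ≤ 1
gain≤1 nothing w [] _ = z≤n
gain≤1 nothing w (c ∷ []) _ = z≤n
gain≤1 nothing w (c ∷ d ∷ r) _ with (c <ᵇ d) ∧ not (c <ᵇ w)
... | true = s≤s z≤n
... | false = z≤n
gain≤1 (just u) w [] _ with w <ᵇ u
... | true = s≤s z≤n
... | false = z≤n
gain≤1 (just u) w (c ∷ []) _ with (w <ᵇ u) ∧ not (w <ᵇ c)
... | true = s≤s z≤n
... | false = z≤n
gain≤1 (just u) w (c ∷ d ∷ r) (w≢c ∷ _) rewrite <ᵇ-flip w c w≢c with w <ᵇ u | w <ᵇ c | c <ᵇ d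
... | true | true | true = s≤s z≤n
... | true | true | false = z≤n
... | true | false | true = s≤s z≤n
... | true | false | false = s≤s z≤n
... | false | true | true = s≤s z≤n
... | false | true | false = z≤n
... | false | false | true = z≤n
... | false | false | false = z≤n

𝟙-isZero+≡1 : ∀ k → k ≤ 1 → 𝟙 (k ≡ᵇ 0) + k ≡ 1
𝟙-isZero+≡1 zero _ = refl
𝟙-isZero+≡1 (suc zero) _ = refl
𝟙-isZero+≡1 (suc (suc k)) (s≤s ())

zeroGains+gainSum : ∀ pr L → Linked _≢_ L → zeroGains pr L + gainSum pr L ≡ length L
zeroGains+gainSum pr [] _ = refl
zeroGains+gainSum pr (w ∷ L) distinct =
  trans (+-interchange (𝟙 (gain pr w L ≡ᵇ 0)) (zeroGains (just w) L) (gain pr w L) (gainSum (just w) L))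
    (cong₂ _+_ (𝟙-isZero+≡1 (gain pr w L) (gain≤1 pr w L distinct)) (zeroGains+gainSum (just w) L (Linked.tail distinct)))

gainSum-fromMinimum : ∀ y w L → y < w → Linked _≢_ (w ∷ L) →
  gainSum nothing (y ∷ w ∷ L) + 2 * valleysℕ (y ∷ w ∷ L) + 2 ≡ length (y ∷ w ∷ L)
gainSum-fromMinimum y w [] y<w _ rewrite ≤⇒<ᵇ-false (<⇒≤ y<w) = refl
gainSum-fromMinimum y w (c ∷ L) y<w distinct = begin
    0 + gainRight y (w ∷ c ∷ L) + X + 2 * V + 2   ≡⟨ cong (λ k → 0 + k + X + 2 * V + 2) gainRight≡ ⟩
    0 + 𝟙 (w <ᵇ c) + X + 2 * V + 2              ≡⟨ regroup (𝟙 (w <ᵇ c)) X V ⟩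
    suc (X + 2 * V + suc (𝟙 (w <ᵇ c)))          ≡⟨ cong suc (subst (λ b → X + 2 * V + b ≡ length (w ∷ c ∷ L)) boundary≡ (gainSum-valleys y w (c ∷ L) distinct)) ⟩
    suc (length (w ∷ c ∷ L)) ∎
  where
  open ≡-Reasoning
  X = gainSum (just y) (w ∷ c ∷ L)
  V = valleysℕ (y ∷ w ∷ c ∷ L)
  gainRight≡ : gainRight y (w ∷ c ∷ L) ≡ 𝟙 (w <ᵇ c)
  gainRight≡ rewrite ≤⇒<ᵇ-false (<⇒≤ y<w) = cong 𝟙 (∧-identityʳ (w <ᵇ c))
  boundary≡ : boundary y w (c ∷ L) ≡ suc (𝟙 (w <ᵇ c))
  boundary≡ rewrite ≤⇒<ᵇ-false (<⇒≤ y<w) = refl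
  regroup : ∀ e x v → 0 + e + x + 2 * v + 2 ≡ suc (x + 2 * v + suc e)
  regroup = solve-∀

zeroGains-fromMinimum : ∀ y w L → y < w → Linked _≢_ (y ∷ w ∷ L) → zeroGains nothing (y ∷ w ∷ L) ≡ 2 * valleysℕ (y ∷ w ∷ L) + 2
zeroGains-fromMinimum y w L y<w distinct = +-cancelʳ-≡ S _ _ (begin
    zeroGains nothing (y ∷ w ∷ L) + S ≡⟨ zeroGains+gainSum nothing (y ∷ w ∷ L) distinct ⟩
    length (y ∷ w ∷ L)              ≡⟨ sym (gainSum-fromMinimum y w L y<w (Linked.tail distinct)) ⟩
    S + 2 * V + 2                   ≡⟨ regroup S V ⟩
    2 * V + 2 + S ∎)
  where
  open ≡-Reasoning
  S = gainSum nothing (y ∷ w ∷ L)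
  V = valleysℕ (y ∷ w ∷ L)
  regroup : ∀ s v → s + 2 * v + 2 ≡ 2 * v + 2 + s
  regroup = solve-∀

≡ᵇ-refl : ∀ w → (w ≡ᵇ w) ≡ true
≡ᵇ-refl zero = refl
≡ᵇ-refl (suc w) = ≡ᵇ-refl w

≡ᵇ-true⇒≡ : ∀ a b → (a ≡ᵇ b) ≡ true → a ≡ b
≡ᵇ-true⇒≡ zero zero _ = refl
≡ᵇ-true⇒≡ (suc a) (suc b) e = cong suc (≡ᵇ-true⇒≡ a b e)

≢⇒≡ᵇ-false : ∀ a b → a ≢ b → (a ≡ᵇ b) ≡ false
≢⇒≡ᵇ-false a b a≢b with a ≡ᵇ b in e
... | true = ⊥-elim (a≢b (≡ᵇ-true⇒≡ a b e))
... | false = refl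

∑-zeroGain≡zeroGains : ∀ pr L → Unique L → ∑ (λ z → 𝟙 (gainAt pr z L ≡ᵇ 0)) L ≡ zeroGains pr L
∑-zeroGain≡zeroGains pr [] _ = refl
∑-zeroGain≡zeroGains pr (w ∷ L) u rewrite ≡ᵇ-refl w = cong (𝟙 (gain pr w L ≡ᵇ 0) +_)
  (trans (∑-cong L (λ z m → cong (λ b → 𝟙 ((if b then gain pr w L else gainAt (just w) z L) ≡ᵇ 0)) (≢⇒≡ᵇ-false w z (λ e → Unique-head u (subst (_∈ L) (sym e) m)))))
         (∑-zeroGain≡zeroGains (just w) L (Unique-tail u)))

gainAt-∉ : ∀ pr a L → a ∉ L → gainAt pr a L ≡ 0
gainAt-∉ pr a [] _ = refl
gainAt-∉ pr a (w ∷ L) a∉ rewrite ≢⇒≡ᵇ-false w a (λ e → a∉ (here (sym e))) = gainAt-∉ (just w) a L (λ m → a∉ (there m))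

gainAt≤1 : ∀ pr a L → Linked _≢_ L → gainAt pr a L ≤ 1
gainAt≤1 pr a [] _ = z≤n
gainAt≤1 pr a (w ∷ L) distinct with w ≡ᵇ a
... | true = gain≤1 pr w L distinct
... | false = gainAt≤1 (just w) a L (Linked.tail distinct)

insertNewAfter : {n : ℕ} → Fin n → List (Fin n) → List (Fin (suc n))
insertNewAfter x [] = []
insertNewAfter {n} x (w ∷ L) = if ⌊ w ≟ᶠ x ⌋ then inject₁ w ∷ fromℕ n ∷ map inject₁ L else inject₁ w ∷ insertNewAfter x L

insertNewAfter-∉ : {n : ℕ} (x : Fin n) (L : List (Fin n)) → x ∉ L → insertNewAfter x L ≡ map inject₁ L
insertNewAfter-∉ x [] _ = refl
insertNewAfter-∉ x (w ∷ L) nm with w ≟ᶠ x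
... | yes e = ⊥-elim (nm (here (sym e)))
... | no _ = cong (inject₁ w ∷_) (insertNewAfter-∉ x L (λ m → nm (there m)))

length-insertNewAfter : {n : ℕ} (x : Fin n) (L : List (Fin n)) → length (insertNewAfter x L) ≤ suc (length L)
length-insertNewAfter x [] = z≤n
length-insertNewAfter x (w ∷ L) with w ≟ᶠ x
... | yes _ = s≤s (s≤s (≤-reflexive (Data.List.Properties.length-map inject₁ L)))
... | no _ = s≤s (length-insertNewAfter x L)

map-toℕ-inject₁ : {n : ℕ} (L : List (Fin n)) → map toℕ (map inject₁ L) ≡ map toℕ L
map-toℕ-inject₁ [] = refl
map-toℕ-inject₁ (w ∷ L) = cong₂ _∷_ (toℕ-inject₁ w) (map-toℕ-inject₁ L)

map-toℕ-insertNewAfter : {n : ℕ} (x : Fin n) (L : List (Fin n)) → map toℕ (insertNewAfter x L) ≡ insertAfter (toℕ x) n (map toℕ L)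
map-toℕ-insertNewAfter x [] = refl
map-toℕ-insertNewAfter {n} x (w ∷ L) with w ≟ᶠ x
... | yes refl rewrite ≡ᵇ-refl (toℕ w) = cong₂ _∷_ (toℕ-inject₁ w) (cong₂ _∷_ (toℕ-fromℕ n) (map-toℕ-inject₁ L))
... | no ne rewrite ≢⇒≡ᵇ-false (toℕ w) (toℕ x) (λ e → ne (toℕ-injective e)) = cong₂ _∷_ (toℕ-inject₁ w) (map-toℕ-insertNewAfter x L)

valleys≡valleysℕ : {m : ℕ} (L : List (Fin m)) → valleys L ≡ valleysℕ (map toℕ L)
valleys≡valleysℕ [] = refl
valleys≡valleysℕ (a ∷ []) = refl
valleys≡valleysℕ (a ∷ b ∷ []) = refl
valleys≡valleysℕ (a ∷ b ∷ c ∷ r) = cong (𝟙 ((toℕ b <ᵇ toℕ a) ∧ (toℕ b <ᵇ toℕ c)) +_) (valleys≡valleysℕ (b ∷ c ∷ r))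

All<-map-toℕ : {n : ℕ} (L : List (Fin n)) → All (_< n) (map toℕ L)
All<-map-toℕ [] = []
All<-map-toℕ (w ∷ L) = toℕ<n w ∷ All<-map-toℕ L

valleyGain : {n : ℕ} → Fin n → List (Fin n) → ℕ
valleyGain x L = gainAt nothing (toℕ x) (map toℕ L)

valleys-insertNewAfter : {n : ℕ} (x : Fin n) (L : List (Fin n)) → valleys (insertNewAfter x L) ≡ valleys L + valleyGain x L
valleys-insertNewAfter {n} x L = trans (valleys≡valleysℕ (insertNewAfter x L)) (trans (cong valleysℕ (map-toℕ-insertNewAfter x L))
  (trans (valleysℕ-insertAfter (toℕ x) n (map toℕ L) (All<-map-toℕ L)) (cong (_+ valleyGain x L) (sym (valleys≡valleysℕ L)))))

valleys-map-inject₁ : {n : ℕ} (L : List (Fin n)) → valleys (map inject₁ L) ≡ valleys L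
valleys-map-inject₁ L = trans (valleys≡valleysℕ (map inject₁ L)) (trans (cong valleysℕ (map-toℕ-inject₁ L)) (sym (valleys≡valleysℕ L)))

allᵇ-cong : {A : Set} (p q : A → Bool) (L : List A) → (∀ w → p w ≡ q w) → allᵇ p L ≡ allᵇ q L
allᵇ-cong p q [] e = refl
allᵇ-cong p q (w ∷ L) e = cong₂ _∧_ (e w) (allᵇ-cong p q L e)

allᵇ-map : {A B : Set} (p : B → Bool) (f : A → B) (L : List A) → allᵇ p (map f L) ≡ allᵇ (p ∘ f) L
allᵇ-map p f [] = refl
allᵇ-map p f (w ∷ L) = cong (p (f w) ∧_) (allᵇ-map p f L)

allᵇ-insertNewAfter : {n : ℕ} (p : Fin (suc n) → Bool) (x : Fin n) (L : List (Fin n)) → p (fromℕ n) ≡ true → allᵇ p (insertNewAfter x L) ≡ allᵇ (p ∘ inject₁) L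
allᵇ-insertNewAfter p x [] _ = refl
allᵇ-insertNewAfter p x (w ∷ L) pN with w ≟ᶠ x
... | yes _ rewrite pN = cong (p (inject₁ w) ∧_) (allᵇ-map p inject₁ L)
... | no _ = cong (p (inject₁ w) ∧_) (allᵇ-insertNewAfter p x L pN)

Path-map-inject₁ : {n : ℕ} (f : Fin n → Fin n) (G : Fin (suc n) → Fin (suc n)) {s z : Fin n} {L : List (Fin n)} →
  Path f s z L → (∀ w → w ∈ L → G (inject₁ w) ≡ inject₁ (f w)) → Path G (inject₁ s) (inject₁ z) (map inject₁ L)
Path-map-inject₁ f G {s} {z} (stop e) h = stop (trans (h z (here refl)) (cong inject₁ e))
Path-map-inject₁ f G {s} {z} (step {L = L} ne P) h =
  step (λ e → ne (inject₁-injective (trans (sym (h z (here refl))) e)))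
       (subst (λ w → Path G (inject₁ s) w (map inject₁ L)) (sym (h z (here refl))) (Path-map-inject₁ f G P (λ w m → h w (there m))))

Path-insertNewAfter : {n : ℕ} (f : Fin n → Fin n) (G : Fin (suc n) → Fin (suc n)) (x : Fin n) {s z : Fin n} {L : List (Fin n)} →
  Path f s z L → x ∈ L → Unique L → (∀ w → w ≢ x → G (inject₁ w) ≡ inject₁ (f w)) →
  G (inject₁ x) ≡ fromℕ n → G (fromℕ n) ≡ inject₁ (f x) → Path G (inject₁ s) (inject₁ z) (insertNewAfter x L)
Path-insertNewAfter {n} f G x {s} {z} (stop e) (here refl) u h hx hN with z ≟ᶠ z
... | no ne = ⊥-elim (ne refl)
... | yes _ = step (λ e' → fromℕ≢inject₁ (trans (sym hx) e'))
                  (subst (λ w → Path G (inject₁ s) w (fromℕ n ∷ [])) (sym hx) (stop (trans hN (cong inject₁ e))))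
Path-insertNewAfter {n} f G x {s} {z} (step {L = L} ne P) xm u h hx hN with z ≟ᶠ x
... | yes refl = step (λ e' → fromℕ≢inject₁ (trans (sym hx) e'))
         (subst (λ w → Path G (inject₁ s) w (fromℕ n ∷ map inject₁ L)) (sym hx)
           (step (λ e' → ne (inject₁-injective (trans (sym hN) e')))
             (subst (λ w → Path G (inject₁ s) w (map inject₁ L)) (sym hN)
               (Path-map-inject₁ f G P (λ w m → h w (λ e' → Unique-head u (subst (_∈ L) e' m)))))))
... | no zx = step (λ e' → ne (inject₁-injective (trans (sym (h z zx)) e')))
         (subst (λ w → Path G (inject₁ s) w (insertNewAfter x L)) (sym (h z zx))
           (Path-insertNewAfter f G x P (x∈L xm) (Unique-tail u) h hx hN))
  where
  x∈L : x ∈ z ∷ L → x ∈ L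
  x∈L (here e) = ⊥-elim (zx (sym e))
  x∈L (there m) = m

∈-orbitFrom-start : {m : ℕ} (g : Fin m → Fin m) (k : ℕ) (s z : Fin m) → 1 ≤ k → z ∈ orbitFrom g k s z
∈-orbitFrom-start g (suc k) s z _ = here refl

module Insertion {n : ℕ} (σ : Vec (Fin n) n) (inj : Inj (lookup σ)) where
  open Cycles σ inj public

  f : Fin n → Fin n
  f = lookup σ

  πafter : Fin n → Vec (Fin (suc n)) (suc n)
  πafter x = insertV σ (just (f x))

  πfixed : Vec (Fin (suc n)) (suc n)
  πfixed = insertV σ nothing

  πafter-other : ∀ x z → z ≢ x → lookup (πafter x) (inject₁ z) ≡ inject₁ (f z)
  πafter-other x z ne = trans (lookup-insertV σ _ (inject₁ z)) (trans (insertAt-inject₁ f (just (f x)) z) (insertOld-miss f (f x) z (λ e → ne (inj e))))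

  πafter-at : ∀ x → lookup (πafter x) (inject₁ x) ≡ fromℕ n
  πafter-at x = trans (lookup-insertV σ _ (inject₁ x)) (trans (insertAt-inject₁ f (just (f x)) x) (insertOld-hit f (f x) x refl))

  πafter-new : ∀ x → lookup (πafter x) (fromℕ n) ≡ inject₁ (f x)
  πafter-new x = trans (lookup-insertV σ _ (fromℕ n)) (insertAt-fromℕ f (just (f x)))

  πfixed-old : ∀ z → lookup πfixed (inject₁ z) ≡ inject₁ (f z)
  πfixed-old z = trans (lookup-insertV σ _ (inject₁ z)) (insertAt-inject₁ f nothing z)

  πfixed-new : lookup πfixed (fromℕ n) ≡ fromℕ n
  πfixed-new = trans (lookup-insertV σ _ (fromℕ n)) (insertAt-fromℕ f nothing)

  cycleOf-πafter : ∀ x y → cycleOf (πafter x) (inject₁ y) ≡ insertNewAfter x (orbit y)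
  cycleOf-πafter x y with DecMem._∈?_ _≟ᶠ_ x (orbit y)
  ... | yes xm = orbitFrom-Path (lookup (πafter x)) (Path-insertNewAfter f (lookup (πafter x)) x (Path-orbit y) xm (Unique-orbit y) (πafter-other x) (πafter-at x) (πafter-new x))
                   (suc n) (≤-trans (length-insertNewAfter x (orbit y)) (s≤s (length-orbit y)))
  ... | no nx = trans (orbitFrom-Path (lookup (πafter x)) (Path-map-inject₁ f (lookup (πafter x)) (Path-orbit y) (λ w m → πafter-other x w (λ e → nx (subst (_∈ orbit y) e m))))
                   (suc n) (≤-trans (≤-reflexive (Data.List.Properties.length-map inject₁ (orbit y))) (≤-trans (length-orbit y) (n≤1+n n))))
                   (sym (insertNewAfter-∉ x (orbit y) nx))

  cycleOf-πfixed : ∀ y → cycleOf πfixed (inject₁ y) ≡ map inject₁ (orbit y)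
  cycleOf-πfixed y = orbitFrom-Path (lookup πfixed) (Path-map-inject₁ f (lookup πfixed) (Path-orbit y) (λ w _ → πfixed-old w))
             (suc n) (≤-trans (≤-reflexive (Data.List.Properties.length-map inject₁ (orbit y))) (≤-trans (length-orbit y) (n≤1+n n)))

  notBelow₊-new : ∀ (y : Fin n) → not (toℕ (fromℕ n) <ᵇ toℕ (inject₁ y)) ≡ true
  notBelow₊-new y rewrite toℕ-fromℕ n | toℕ-inject₁ y = ≤⇒not-<ᵇ (<⇒≤ (toℕ<n y))

  notBelow₊-inject₁ : ∀ (y w : Fin n) → not (toℕ (inject₁ w) <ᵇ toℕ (inject₁ y)) ≡ not (toℕ w <ᵇ toℕ y)
  notBelow₊-inject₁ y w rewrite toℕ-inject₁ w | toℕ-inject₁ y = refl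

  notBelow₊ : Fin n → Fin (suc n) → Bool
  notBelow₊ y w = not (toℕ w <ᵇ toℕ (inject₁ y))

  notBelow : Fin n → Fin n → Bool
  notBelow y w = not (toℕ w <ᵇ toℕ y)

  isCycleMin-πafter : ∀ x y → isCycleMin (πafter x) (inject₁ y) ≡ isMin y
  isCycleMin-πafter x y = trans (cong (allᵇ (notBelow₊ y)) (cycleOf-πafter x y)) (trans (allᵇ-insertNewAfter (notBelow₊ y) x (orbit y) (notBelow₊-new y))
             (trans (allᵇ-cong (notBelow₊ y ∘ inject₁) (notBelow y) (orbit y) (notBelow₊-inject₁ y)) (cong (allᵇ (notBelow y)) (sym (cycleOf≡orbit y)))))

  isCycleMin-πfixed : ∀ y → isCycleMin πfixed (inject₁ y) ≡ isMin y
  isCycleMin-πfixed y = trans (cong (allᵇ (notBelow₊ y)) (cycleOf-πfixed y)) (trans (allᵇ-map (notBelow₊ y) inject₁ (orbit y))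
             (trans (allᵇ-cong (notBelow₊ y ∘ inject₁) (notBelow y) (orbit y) (notBelow₊-inject₁ y)) (cong (allᵇ (notBelow y)) (sym (cycleOf≡orbit y)))))

  cycleOf-πfixed-new : cycleOf πfixed (fromℕ n) ≡ fromℕ n ∷ []
  cycleOf-πfixed-new with lookup πfixed (fromℕ n) ≟ᶠ fromℕ n
  ... | yes _ = refl
  ... | no ne = ⊥-elim (ne πfixed-new)

  isCycleMin-πfixed-new : isCycleMin πfixed (fromℕ n) ≡ true
  isCycleMin-πfixed-new = trans (cong (allᵇ (λ w → not (toℕ w <ᵇ toℕ (fromℕ n)))) cycleOf-πfixed-new) (cong (_∧ true) (≤⇒not-<ᵇ {toℕ (fromℕ n)} ≤-refl))

  isCycleMin-πafter-new : ∀ x → isCycleMin (πafter x) (fromℕ n) ≡ false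
  isCycleMin-πafter-new x with isCycleMin (πafter x) (fromℕ n) in e
  ... | false = refl
  ... | true = ⊥-elim (<⇒≱ lt (not-<ᵇ⇒≤ _ _ (allᵇ-elim _ (cycleOf (πafter x) (fromℕ n)) e (inject₁ (f x)) mem)))
    where
    lt : toℕ (inject₁ (f x)) < toℕ (fromℕ n)
    lt rewrite toℕ-inject₁ (f x) | toℕ-fromℕ n = toℕ<n (f x)
    mem : inject₁ (f x) ∈ cycleOf (πafter x) (fromℕ n)
    mem with lookup (πafter x) (fromℕ n) ≟ᶠ fromℕ n
    ... | yes e' = ⊥-elim (fromℕ≢inject₁ (trans (sym e') (πafter-new x)))
    ... | no _ = there (subst (_∈ orbitFrom (lookup (πafter x)) n (fromℕ n) (lookup (πafter x) (fromℕ n))) (πafter-new x)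
                   (∈-orbitFrom-start (lookup (πafter x)) n (fromℕ n) (lookup (πafter x) (fromℕ n)) (≤-trans (s≤s z≤n) (toℕ<n x))))

  ≟-inject₁ : ∀ (a b : Fin n) → ⌊ inject₁ a ≟ᶠ inject₁ b ⌋ ≡ ⌊ a ≟ᶠ b ⌋
  ≟-inject₁ a b = ⌊⌋-cong inject₁-injective (cong inject₁) (inject₁ a ≟ᶠ inject₁ b) (a ≟ᶠ b)

  fix-suc : (π : Vec (Fin (suc n)) (suc n)) → fix π ≡ 𝟙 ⌊ lookup π (fromℕ n) ≟ᶠ fromℕ n ⌋ + ∑ (λ z → 𝟙 ⌊ lookup π (inject₁ z) ≟ᶠ inject₁ z ⌋) (allFin n)
  fix-suc π = trans (countᵇ≡∑ _ (allFin (suc n))) (∑-allFin-suc (λ i → 𝟙 ⌊ lookup π i ≟ᶠ i ⌋))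

  fix-πfixed : fix πfixed ≡ suc (fix σ)
  fix-πfixed rewrite fix-suc πfixed | fix≡∑ σ | πfixed-new =
    cong₂ _+_ (cong 𝟙 (⌊⌋-true (fromℕ n ≟ᶠ fromℕ n) refl))
      (∑-cong (allFin n) (λ z _ → trans (cong (λ w → 𝟙 ⌊ w ≟ᶠ inject₁ z ⌋) (πfixed-old z)) (cong 𝟙 (≟-inject₁ (f z) z))))

  fix-πafter : ∀ x → fix (πafter x) + 𝟙 ⌊ f x ≟ᶠ x ⌋ ≡ fix σ
  fix-πafter x = begin
      fix (πafter x) + I ≡⟨ cong (_+ I) (fix-suc (πafter x)) ⟩
      𝟙 ⌊ lookup (πafter x) (fromℕ n) ≟ᶠ fromℕ n ⌋ + S' + I ≡⟨ cong (λ k → 𝟙 k + S' + I) (trans (cong (λ w → ⌊ w ≟ᶠ fromℕ n ⌋) (πafter-new x)) (⌊⌋-false (inject₁ (f x) ≟ᶠ fromℕ n) (λ e → fromℕ≢inject₁ (sym e)))) ⟩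
      S' + I ≡⟨ ∑-except (λ z → 𝟙 ⌊ f z ≟ᶠ z ⌋) h' x (allFin n)
        (allFin⁺ n) (∈-allFin x)
        (λ z _ ne → trans (cong (λ w → 𝟙 ⌊ w ≟ᶠ inject₁ z ⌋) (πafter-other x z ne)) (cong 𝟙 (≟-inject₁ (f z) z)))
        (trans (cong (λ w → 𝟙 ⌊ w ≟ᶠ inject₁ x ⌋) (πafter-at x)) (cong 𝟙 (⌊⌋-false (fromℕ n ≟ᶠ inject₁ x) fromℕ≢inject₁))) ⟩
      ∑ (λ z → 𝟙 ⌊ f z ≟ᶠ z ⌋) (allFin n) ≡⟨ sym (fix≡∑ σ) ⟩
      fix σ ∎
    where
    open ≡-Reasoning
    I = 𝟙 ⌊ f x ≟ᶠ x ⌋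
    h' : Fin n → ℕ
    h' z = 𝟙 ⌊ lookup (πafter x) (inject₁ z) ≟ᶠ inject₁ z ⌋
    S' = ∑ h' (allFin n)

  cyc-πfixed : cyc πfixed ≡ suc (cyc σ)
  cyc-πfixed = trans (cyc≡∑ πfixed) (trans (∑-allFin-suc (λ i → 𝟙 (isCycleMin πfixed i)))
    (cong₂ _+_ (cong 𝟙 isCycleMin-πfixed-new) (trans (∑-cong (allFin n) (λ y _ → cong 𝟙 (isCycleMin-πfixed y))) (sym (cyc≡∑ σ)))))

  cyc-πafter : ∀ x → cyc (πafter x) ≡ cyc σ
  cyc-πafter x = trans (cyc≡∑ (πafter x)) (trans (∑-allFin-suc (λ i → 𝟙 (isCycleMin (πafter x) i)))
    (cong₂ _+_ (cong 𝟙 (isCycleMin-πafter-new x)) (trans (∑-cong (allFin n) (λ y _ → cong 𝟙 (isCycleMin-πafter x y))) (sym (cyc≡∑ σ)))))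

  -- The change of cval when n+1 is inserted after x: only the cycle containing x contributes.
  δ : Fin n → ℕ
  δ x = ∑ (λ y → if isMin y then valleyGain x (orbit y) else 0) (allFin n)

  if-split : ∀ (b : Bool) a c → (if b then a + c else 0) ≡ (if b then a else 0) + (if b then c else 0)
  if-split true a c = refl
  if-split false a c = refl

  cval-πfixed : cval πfixed ≡ cval σ
  cval-πfixed = trans (cval≡∑ πfixed) (trans (∑-allFin-suc (λ i → if isCycleMin πfixed i then valleys (cycleOf πfixed i) else 0))
    (trans (cong₂ _+_ newTerm≡0 (∑-cong (allFin n) (λ y _ → oldTerm≡ y))) (sym cval≡∑orbit)))
    where
    newTerm≡0 : (if isCycleMin πfixed (fromℕ n) then valleys (cycleOf πfixed (fromℕ n)) else 0) ≡ 0
    newTerm≡0 rewrite isCycleMin-πfixed-new | cycleOf-πfixed-new = refl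
    oldTerm≡ : ∀ y → (if isCycleMin πfixed (inject₁ y) then valleys (cycleOf πfixed (inject₁ y)) else 0) ≡ (if isMin y then valleys (orbit y) else 0)
    oldTerm≡ y rewrite isCycleMin-πfixed y | cycleOf-πfixed y | valleys-map-inject₁ (orbit y) = refl

  cval-πafter : ∀ x → cval (πafter x) ≡ cval σ + δ x
  cval-πafter x = trans (cval≡∑ (πafter x)) (trans (∑-allFin-suc (λ i → if isCycleMin (πafter x) i then valleys (cycleOf (πafter x) i) else 0))
    (trans (cong₂ _+_ newTerm≡0 (trans (∑-cong (allFin n) (λ y _ → oldTerm≡ y)) (∑-+ _ _ (allFin n))))
    (cong (_+ δ x) (sym cval≡∑orbit))))
    where
    newTerm≡0 : (if isCycleMin (πafter x) (fromℕ n) then valleys (cycleOf (πafter x) (fromℕ n)) else 0) ≡ 0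
    newTerm≡0 rewrite isCycleMin-πafter-new x = refl
    oldTerm≡ : ∀ y → (if isCycleMin (πafter x) (inject₁ y) then valleys (cycleOf (πafter x) (inject₁ y)) else 0) ≡ (if isMin y then valleys (orbit y) else 0) + (if isMin y then valleyGain x (orbit y) else 0)
    oldTerm≡ y rewrite isCycleMin-πafter x y | cycleOf-πafter x y | valleys-insertNewAfter x (orbit y) = if-split (isMin y) _ _

  Unique-map-toℕ-orbit : ∀ y → Unique (map toℕ (orbit y))
  Unique-map-toℕ-orbit y = map⁺ toℕ-injective (Unique-orbit y)

  δ≡valleyGain : ∀ y z → isMin y ≡ true → z ∈ orbit y → δ z ≡ valleyGain z (orbit y)
  δ≡valleyGain y z y-min z∈ = trans (∑-single _ (allFin n) y (allFin⁺ n) (∈-allFin y) other≡0) (cong (λ b → if b then valleyGain z (orbit y) else 0) y-min)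
    where
    other≡0 : ∀ y′ → y′ ∈ allFin n → y′ ≢ y → (if isMin y′ then valleyGain z (orbit y′) else 0) ≡ 0
    other≡0 y′ _ y′≢y with isMin y′ in y′-min
    ... | false = refl
    ... | true = gainAt-∉ nothing (toℕ z) (map toℕ (orbit y′)) (toℕ-∉ (λ z∈′ → y′≢y (isMin-unique y′ y z y′-min y-min z∈′ z∈)))

  δ≤1 : ∀ z → δ z ≤ 1
  δ≤1 z = let y , y-min , z∈ = isMin-exists z in
    subst (_≤ 1) (sym (δ≡valleyGain y z y-min z∈)) (gainAt≤1 nothing (toℕ z) (map toℕ (orbit y)) (AllPairs⇒Linked (Unique-map-toℕ-orbit y)))

  isFixed : Fin n → Bool
  isFixed z = ⌊ f z ≟ᶠ z ⌋

  orbit-fixed : ∀ y → f y ≡ y → orbit y ≡ y ∷ []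
  orbit-fixed y e = cong (iterList f y) (fixed⇒period0 y e)

  orbit-nonfixed : ∀ y → f y ≢ y → ∃[ T ] (orbit y ≡ y ∷ f y ∷ T)
  orbit-nonfixed y fy≢y with per y in p≡
  ... | zero = ⊥-elim (fy≢y (period0⇒fixed y p≡))
  ... | suc zero = [] , refl
  ... | suc (suc c) = iterList f (f (f y)) c , refl

  nonfixed-∈-orbit : ∀ y z → f y ≢ y → z ∈ orbit y → f z ≢ z
  nonfixed-∈-orbit y z fy≢y z∈ fz≡z with orbit-sym y z∈
  ... | y∈ rewrite orbit-fixed z fz≡z with y∈
  ...   | here refl = fy≢y fz≡z

  isFixed-sound : ∀ x → isFixed x ≡ true → f x ≡ x
  isFixed-sound x fixed with f x ≟ᶠ x
  ... | yes fx≡x = fx≡x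

  isNeutral : Fin n → ℕ
  isNeutral x = if isFixed x then 0 else 𝟙 (δ x ≡ᵇ 0)

  isGaining : Fin n → ℕ
  isGaining x = if isFixed x then 0 else (if δ x ≡ᵇ 0 then 0 else 1)

  neutral : ℕ
  neutral = ∑ isNeutral (allFin n)

  gaining : ℕ
  gaining = ∑ isGaining (allFin n)

  slotWeight : Fin n → ℕ
  slotWeight z = isNeutral z + 2 * 𝟙 (isFixed z)

  ∑-slotWeight-orbit : ∀ y → isMin y ≡ true → ∑ slotWeight (orbit y) ≡ 2 * valleys (orbit y) + 2
  ∑-slotWeight-orbit y y-min with f y ≟ᶠ y
  ... | yes fy≡y rewrite orbit-fixed y fy≡y | ⌊⌋-true (f y ≟ᶠ y) fy≡y = refl
  ... | no fy≢y with orbit-nonfixed y fy≢y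
  ...   | T , orbit≡ = begin
      ∑ slotWeight (orbit y)                                   ≡⟨ ∑-cong (orbit y) slotWeight≡ ⟩
      ∑ (λ z → 𝟙 (gainAt nothing (toℕ z) L ≡ᵇ 0)) (orbit y)    ≡⟨ sym (∑-map (λ a → 𝟙 (gainAt nothing a L ≡ᵇ 0)) toℕ (orbit y)) ⟩
      ∑ (λ a → 𝟙 (gainAt nothing a L ≡ᵇ 0)) L                  ≡⟨ ∑-zeroGain≡zeroGains nothing L (Unique-map-toℕ-orbit y) ⟩
      zeroGains nothing L                                       ≡⟨ cong (zeroGains nothing ∘ map toℕ) orbit≡ ⟩
      zeroGains nothing (toℕ y ∷ toℕ (f y) ∷ map toℕ T)         ≡⟨ zeroGains-fromMinimum (toℕ y) (toℕ (f y)) (map toℕ T) y<fy distinct ⟩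
      2 * valleysℕ (toℕ y ∷ toℕ (f y) ∷ map toℕ T) + 2         ≡⟨ cong (λ K → 2 * valleysℕ (map toℕ K) + 2) (sym orbit≡) ⟩
      2 * valleysℕ L + 2                                        ≡⟨ cong (λ k → 2 * k + 2) (sym (valleys≡valleysℕ (orbit y))) ⟩
      2 * valleys (orbit y) + 2 ∎
    where
    open ≡-Reasoning
    L = map toℕ (orbit y)
    slotWeight≡ : ∀ z → z ∈ orbit y → slotWeight z ≡ 𝟙 (gainAt nothing (toℕ z) L ≡ᵇ 0)
    slotWeight≡ z z∈ rewrite ⌊⌋-false (f z ≟ᶠ z) (nonfixed-∈-orbit y z fy≢y z∈) | δ≡valleyGain y z y-min z∈ = +-identityʳ _
    y<fy : toℕ y < toℕ (f y)
    y<fy = ≤∧≢⇒< (isMin-≤ y y-min (f y) (subst (f y ∈_) (sym orbit≡) (there (here refl)))) (λ e → fy≢y (sym (toℕ-injective e)))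
    distinct : Linked _≢_ (toℕ y ∷ toℕ (f y) ∷ map toℕ T)
    distinct = AllPairs⇒Linked (subst (Unique ∘ map toℕ) orbit≡ (Unique-map-toℕ-orbit y))

  neutral+2fix : neutral + 2 * fix σ ≡ 2 * cval σ + 2 * cyc σ
  neutral+2fix = begin
      neutral + 2 * fix σ                                               ≡⟨ cong (λ k → neutral + 2 * k) (fix≡∑ σ) ⟩
      neutral + 2 * ∑ (𝟙 ∘ isFixed) (allFin n)                           ≡⟨ cong (neutral +_) (sym (∑-*ˡ 2 (𝟙 ∘ isFixed) (allFin n))) ⟩
      neutral + ∑ (λ z → 2 * 𝟙 (isFixed z)) (allFin n)                   ≡⟨ sym (∑-+ isNeutral _ (allFin n)) ⟩
      ∑ slotWeight (allFin n)                                           ≡⟨ ∑-by-cycles slotWeight ⟩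
      ∑ (λ y → if isMin y then ∑ slotWeight (orbit y) else 0) (allFin n) ≡⟨ ∑-cong (allFin n) (λ y _ → perCycle y) ⟩
      ∑ (λ y → 2 * valleysIfMin y + 2 * 𝟙 (isMin y)) (allFin n)          ≡⟨ ∑-+ _ _ (allFin n) ⟩
      ∑ (λ y → 2 * valleysIfMin y) (allFin n) + ∑ (λ y → 2 * 𝟙 (isMin y)) (allFin n)
        ≡⟨ cong₂ _+_ (∑-*ˡ 2 valleysIfMin (allFin n)) (∑-*ˡ 2 (𝟙 ∘ isMin) (allFin n)) ⟩
      2 * ∑ valleysIfMin (allFin n) + 2 * ∑ (𝟙 ∘ isMin) (allFin n)       ≡⟨ cong₂ (λ a b → 2 * a + 2 * b) (sym cval≡∑orbit) (sym (cyc≡∑ σ)) ⟩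
      2 * cval σ + 2 * cyc σ ∎
    where
    open ≡-Reasoning
    valleysIfMin : Fin n → ℕ
    valleysIfMin y = if isMin y then valleys (orbit y) else 0
    perCycle : ∀ y → (if isMin y then ∑ slotWeight (orbit y) else 0) ≡ 2 * valleysIfMin y + 2 * 𝟙 (isMin y)
    perCycle y with isMin y in y-min
    ... | true = ∑-slotWeight-orbit y y-min
    ... | false = refl

  neutral+gaining+fix≡n : neutral + gaining + fix σ ≡ n
  neutral+gaining+fix≡n = begin
      neutral + gaining + fix σ                                              ≡⟨ cong₂ _+_ (sym (∑-+ isNeutral isGaining (allFin n))) (fix≡∑ σ) ⟩
      ∑ (λ z → isNeutral z + isGaining z) (allFin n) + ∑ (𝟙 ∘ isFixed) (allFin n) ≡⟨ sym (∑-+ _ _ (allFin n)) ⟩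
      ∑ (λ z → isNeutral z + isGaining z + 𝟙 (isFixed z)) (allFin n)         ≡⟨ ∑-cong (allFin n) (λ z _ → exactlyOne z) ⟩
      ∑ (λ _ → 1) (allFin n)                                                ≡⟨ sym (length≡∑1 (allFin n)) ⟩
      length (allFin n)                                                     ≡⟨ Data.List.Properties.length-tabulate id ⟩
      n ∎
    where
    open ≡-Reasoning
    exactlyOne : ∀ z → isNeutral z + isGaining z + 𝟙 (isFixed z) ≡ 1
    exactlyOne z with isFixed z | δ z ≡ᵇ 0
    ... | true | _ = refl
    ... | false | true = refl
    ... | false | false = refl

open import Data.Integer as ℤ using (ℤ; +_)
import Data.Integer.Properties as ℤₚ
import Data.Integer.Tactic.RingSolver as ℤ-Solver

statsAre : ℤ → ℤ → ℤ → ℕ → ℕ → ℕ → Bool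
statsAre t s r a b c = ⌊ + a ℤ.≟ t ⌋ ∧ ⌊ + b ℤ.≟ s ⌋ ∧ ⌊ + c ℤ.≟ r ⌋

inClass : {m : ℕ} → ℤ → ℤ → ℤ → Vec (Fin m) m → Bool
inClass t s r π = statsAre t s r (cval π) (cyc π) (fix π)

statsAre-sound : ∀ t s r a b c → statsAre t s r a b c ≡ true → (+ a ≡ t) × (+ b ≡ s) × (+ c ≡ r)
statsAre-sound t s r a b c e with + a ℤ.≟ t | + b ℤ.≟ s | + c ℤ.≟ r
... | yes a≡t | yes b≡s | yes c≡r = a≡t , b≡s , c≡r
statsAre-sound t s r a b c () | no _ | _ | _
statsAre-sound t s r a b c () | yes _ | no _ | _
statsAre-sound t s r a b c () | yes _ | yes _ | no _

statsAre-cong : ∀ {t s r a a′ b b′ c c′} → a ≡ a′ → b ≡ b′ → c ≡ c′ → statsAre t s r a b c ≡ statsAre t s r a′ b′ c′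
statsAre-cong refl refl refl = refl

⌊+suc≟⌋ : ∀ k z → ⌊ + suc k ℤ.≟ z ⌋ ≡ ⌊ + k ℤ.≟ z ℤ.- + 1 ⌋
⌊+suc≟⌋ k z = ⌊⌋-cong (λ e → cong (ℤ._- + 1) e) (λ e → trans (cong +_ (+-comm 1 k)) (trans (cong (ℤ._+ + 1) e) (z-1+1 z))) (+ suc k ℤ.≟ z) (+ k ℤ.≟ z ℤ.- + 1)
  where
  z-1+1 : ∀ z → z ℤ.- + 1 ℤ.+ + 1 ≡ z
  z-1+1 = ℤ-Solver.solve-∀

⌊+≟⌋-suc : ∀ k r → ⌊ + k ℤ.≟ r ⌋ ≡ ⌊ + suc k ℤ.≟ r ℤ.+ + 1 ⌋
⌊+≟⌋-suc k r = trans (cong (λ w → ⌊ + k ℤ.≟ w ⌋) (sym (r+1-1 r))) (sym (⌊+suc≟⌋ k (r ℤ.+ + 1)))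
  where
  r+1-1 : ∀ r → r ℤ.+ + 1 ℤ.- + 1 ≡ r
  r+1-1 = ℤ-Solver.solve-∀

*-𝟙-cong : ∀ (b : Bool) (X Y : ℤ) → (b ≡ true → X ≡ Y) → X ℤ.* + 𝟙 b ≡ Y ℤ.* + 𝟙 b
*-𝟙-cong true X Y h = cong (ℤ._* + 1) (h refl)
*-𝟙-cong false X Y h = trans (ℤₚ.*-zeroʳ X) (sym (ℤₚ.*-zeroʳ Y))

∑ℤ : {A : Set} → (A → ℤ) → List A → ℤ
∑ℤ f [] = + 0
∑ℤ f (x ∷ xs) = f x ℤ.+ ∑ℤ f xs

+∑≡∑ℤ : {A : Set} (f : A → ℕ) (xs : List A) → + ∑ f xs ≡ ∑ℤ (λ x → + f x) xs
+∑≡∑ℤ f [] = refl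
+∑≡∑ℤ f (x ∷ xs) = trans (ℤₚ.pos-+ (f x) (∑ f xs)) (cong (λ w → + f x ℤ.+ w) (+∑≡∑ℤ f xs))

∑ℤ-cong : {A : Set} {f g : A → ℤ} (xs : List A) → (∀ x → x ∈ xs → f x ≡ g x) → ∑ℤ f xs ≡ ∑ℤ g xs
∑ℤ-cong [] e = refl
∑ℤ-cong (x ∷ xs) e = cong₂ ℤ._+_ (e x (here refl)) (∑ℤ-cong xs (λ y m → e y (there m)))

∑ℤ-linear : {A : Set} (a b c : ℤ) (f g h k : A → ℤ) (xs : List A) →
  ∑ℤ (λ x → (a ℤ.* f x ℤ.+ g x) ℤ.+ (b ℤ.* h x ℤ.+ c ℤ.* k x)) xs ≡
  (a ℤ.* ∑ℤ f xs ℤ.+ ∑ℤ g xs) ℤ.+ (b ℤ.* ∑ℤ h xs ℤ.+ c ℤ.* ∑ℤ k xs)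
∑ℤ-linear a b c f g h k [] = zeros a b c
  where
  zeros : ∀ a b c → + 0 ≡ (a ℤ.* + 0 ℤ.+ + 0) ℤ.+ (b ℤ.* + 0 ℤ.+ c ℤ.* + 0)
  zeros = ℤ-Solver.solve-∀
∑ℤ-linear a b c f g h k (x ∷ xs) = trans (cong (λ w → (a ℤ.* f x ℤ.+ g x) ℤ.+ (b ℤ.* h x ℤ.+ c ℤ.* k x) ℤ.+ w) (∑ℤ-linear a b c f g h k xs)) (regroup a b c (f x) (g x) (h x) (k x) (∑ℤ f xs) (∑ℤ g xs) (∑ℤ h xs) (∑ℤ k xs))
  where
  regroup : ∀ a b c f g h k F G H K →
    (a ℤ.* f ℤ.+ g) ℤ.+ (b ℤ.* h ℤ.+ c ℤ.* k) ℤ.+ ((a ℤ.* F ℤ.+ G) ℤ.+ (b ℤ.* H ℤ.+ c ℤ.* K)) ≡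
    (a ℤ.* (f ℤ.+ F) ℤ.+ (g ℤ.+ G)) ℤ.+ (b ℤ.* (h ℤ.+ H) ℤ.+ c ℤ.* (k ℤ.+ K))
  regroup = ℤ-Solver.solve-∀

classCount : {n : ℕ} → ℤ → ℤ → ℤ → Vec (Fin n) n → ℕ
classCount {n} t s r σ = ∑ (λ p → 𝟙 (inClass t s r (insertV σ p))) (slots n)

v-suc≡∑classCount : ∀ n t s r → v (suc n) t s r ≡ ∑ (classCount t s r) (Sym n)
v-suc≡∑classCount n t s r = trans (countᵇ≡∑ _ (Sym (suc n))) (∑-Sym-suc n (𝟙 ∘ inClass t s r))

∑ℤ-inClass : ∀ n t s r → ∑ℤ (λ σ → + 𝟙 (inClass t s r σ)) (Sym n) ≡ + v n t s r
∑ℤ-inClass n t s r = sym (trans (cong +_ (countᵇ≡∑ _ (Sym n))) (+∑≡∑ℤ _ (Sym n)))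

𝟙-by-slotKind : ∀ (e fixed : Bool) (d : ℕ) (b₀ b₁ b₂ : Bool) → d ≤ 1 →
  (fixed ≡ true → e ≡ b₁) → (fixed ≡ false → d ≡ 0 → e ≡ b₀) → (fixed ≡ false → d ≡ 1 → e ≡ b₂) →
  𝟙 e ≡ 𝟙 fixed * 𝟙 b₁ + ((if fixed then 0 else 𝟙 (d ≡ᵇ 0)) * 𝟙 b₀ + (if fixed then 0 else (if d ≡ᵇ 0 then 0 else 1)) * 𝟙 b₂)
𝟙-by-slotKind e true d b₀ b₁ b₂ _ h₁ h₀ h₂ rewrite h₁ refl = sym (trans (+-identityʳ _) (+-identityʳ _))
𝟙-by-slotKind e false zero b₀ b₁ b₂ _ h₁ h₀ h₂ rewrite h₀ refl refl = sym (trans (+-identityʳ _) (+-identityʳ _))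
𝟙-by-slotKind e false (suc zero) b₀ b₁ b₂ _ h₁ h₀ h₂ rewrite h₂ refl refl = sym (+-identityʳ _)
𝟙-by-slotKind e false (suc (suc d)) b₀ b₁ b₂ (s≤s ()) h₁ h₀ h₂

module ClassCount {n : ℕ} (σ : Vec (Fin n) n) (inj : Inj (lookup σ)) (t s r : ℤ) where
  open Insertion σ inj

  a = cval σ
  b = cyc σ
  c = fix σ
  viaNewFixed = statsAre t (s ℤ.- + 1) (r ℤ.- + 1) a b c
  viaFixed = statsAre t s (r ℤ.+ + 1) a b c
  viaNeutral = statsAre t s r a b c
  viaGain = statsAre (t ℤ.- + 1) s r a b c

  inClass-πfixed : inClass t s r πfixed ≡ viaNewFixed
  inClass-πfixed rewrite cval-πfixed | cyc-πfixed | fix-πfixed = cong₂ (λ u w → ⌊ + a ℤ.≟ t ⌋ ∧ u ∧ w) (⌊+suc≟⌋ b s) (⌊+suc≟⌋ c r)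

  δ-fixed : ∀ x → f x ≡ x → δ x ≡ 0
  δ-fixed x fx≡x = trans (δ≡valleyGain x x x-min (∈-orbit-self x)) (trans (cong (valleyGain x) (orbit-fixed x fx≡x)) gain-singleton)
    where
    x-min : isMin x ≡ true
    x-min = isMin-intro x (λ w w∈ → go w (subst (w ∈_) (orbit-fixed x fx≡x) w∈))
      where
      go : ∀ w → w ∈ x ∷ [] → toℕ x ≤ toℕ w
      go w (here refl) = ≤-refl
    gain-singleton : gainAt nothing (toℕ x) (toℕ x ∷ []) ≡ 0
    gain-singleton rewrite ≡ᵇ-refl (toℕ x) = refl

  fix-πafter-nonfixed : ∀ x → isFixed x ≡ false → fix (πafter x) ≡ c
  fix-πafter-nonfixed x nonfixed = trans (sym (+-identityʳ _)) (trans (cong (λ w → fix (πafter x) + w) (sym (cong 𝟙 nonfixed))) (fix-πafter x))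

  inClass-πafter-fixed : ∀ x → isFixed x ≡ true → inClass t s r (πafter x) ≡ viaFixed
  inClass-πafter-fixed x fixed = trans (statsAre-cong {t} {s} {r} cval≡ (cyc-πafter x) refl)
      (cong (λ w → ⌊ + a ℤ.≟ t ⌋ ∧ ⌊ + b ℤ.≟ s ⌋ ∧ w) (trans (⌊+≟⌋-suc (fix (πafter x)) r) (cong (λ k → ⌊ + k ℤ.≟ r ℤ.+ + 1 ⌋) fix≡)))
    where
    fx≡x : f x ≡ x
    fx≡x = isFixed-sound x fixed
    cval≡ : cval (πafter x) ≡ a
    cval≡ = trans (cval-πafter x) (trans (cong (λ w → a + w) (δ-fixed x fx≡x)) (+-identityʳ a))
    fix≡ : suc (fix (πafter x)) ≡ c
    fix≡ = trans (+-comm 1 _) (trans (cong (λ w → fix (πafter x) + w) (sym (cong 𝟙 fixed))) (fix-πafter x))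

  inClass-πafter-neutral : ∀ x → isFixed x ≡ false → δ x ≡ 0 → inClass t s r (πafter x) ≡ viaNeutral
  inClass-πafter-neutral x nonfixed δ≡0 =
    statsAre-cong {t} {s} {r} (trans (cval-πafter x) (trans (cong (λ w → a + w) δ≡0) (+-identityʳ a))) (cyc-πafter x) (fix-πafter-nonfixed x nonfixed)

  inClass-πafter-gain : ∀ x → isFixed x ≡ false → δ x ≡ 1 → inClass t s r (πafter x) ≡ viaGain
  inClass-πafter-gain x nonfixed δ≡1 =
    trans (statsAre-cong {t} {s} {r} (trans (cval-πafter x) (trans (cong (λ w → a + w) δ≡1) (+-comm a 1))) (cyc-πafter x) (fix-πafter-nonfixed x nonfixed))
      (cong (λ w → w ∧ ⌊ + b ℤ.≟ s ⌋ ∧ ⌊ + c ℤ.≟ r ⌋) (⌊+suc≟⌋ a t))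

  𝟙-inClass-πafter : ∀ x → 𝟙 (inClass t s r (πafter x)) ≡ 𝟙 (isFixed x) * 𝟙 viaFixed + (isNeutral x * 𝟙 viaNeutral + isGaining x * 𝟙 viaGain)
  𝟙-inClass-πafter x = 𝟙-by-slotKind _ (isFixed x) (δ x) viaNeutral viaFixed viaGain (δ≤1 x)
    (inClass-πafter-fixed x) (inClass-πafter-neutral x) (inClass-πafter-gain x)

  classCount≡ : classCount t s r σ ≡ 𝟙 viaNewFixed + (c * 𝟙 viaFixed + (neutral * 𝟙 viaNeutral + gaining * 𝟙 viaGain))
  classCount≡ = begin
      classCount t s r σ                                               ≡⟨ cong (_+ ∑ lands (map just (allFin n))) (cong 𝟙 inClass-πfixed) ⟩
      𝟙 viaNewFixed + ∑ lands (map just (allFin n))                     ≡⟨ cong (λ w → 𝟙 viaNewFixed + w) (∑-map lands just (allFin n)) ⟩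
      𝟙 viaNewFixed + ∑ (lands ∘ just) (allFin n)                       ≡⟨ cong (λ w → 𝟙 viaNewFixed + w) (∑-allFin-bijection f inj surj (lands ∘ just)) ⟩
      𝟙 viaNewFixed + ∑ (λ x → 𝟙 (inClass t s r (πafter x))) (allFin n) ≡⟨ cong (λ w → 𝟙 viaNewFixed + w) (∑-cong (allFin n) (λ x _ → 𝟙-inClass-πafter x)) ⟩
      𝟙 viaNewFixed + ∑ (λ x → 𝟙 (isFixed x) * 𝟙 viaFixed + (isNeutral x * 𝟙 viaNeutral + isGaining x * 𝟙 viaGain)) (allFin n)
        ≡⟨ cong (λ w → 𝟙 viaNewFixed + w) (trans (∑-+ _ _ (allFin n)) (cong₂ _+_ (trans (∑-*ʳ _ (𝟙 viaFixed)) (cong (_* 𝟙 viaFixed) (sym (fix≡∑ σ))))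
              (trans (∑-+ _ _ (allFin n)) (cong₂ _+_ (∑-*ʳ isNeutral (𝟙 viaNeutral)) (∑-*ʳ isGaining (𝟙 viaGain)))))) ⟩
      𝟙 viaNewFixed + (c * 𝟙 viaFixed + (neutral * 𝟙 viaNeutral + gaining * 𝟙 viaGain)) ∎
    where
    open ≡-Reasoning
    lands : Maybe (Fin n) → ℕ
    lands p = 𝟙 (inClass t s r (insertV σ p))
    ∑-*ʳ : (g : Fin n → ℕ) (k : ℕ) → ∑ (λ x → g x * k) (allFin n) ≡ ∑ g (allFin n) * k
    ∑-*ʳ g k = trans (∑-cong (allFin n) (λ x _ → *-comm (g x) k)) (trans (∑-*ˡ k g (allFin n)) (*-comm k _))

  neutralCoefficient : ℤ
  neutralCoefficient = + 2 ℤ.* t ℤ.+ + 2 ℤ.* s ℤ.- + 2 ℤ.* r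

  gainCoefficient : ℤ
  gainCoefficient = + n ℤ.+ + 2 ℤ.- + 2 ℤ.* t ℤ.- + 2 ℤ.* s ℤ.+ r

  +neutral≡ : + neutral ≡ + 2 ℤ.* + a ℤ.+ + 2 ℤ.* + b ℤ.- + 2 ℤ.* + c
  +neutral≡ = trans (x≡x+y-y (+ neutral) (+ 2 ℤ.* + c)) (cong (ℤ._- + 2 ℤ.* + c) (begin
      + neutral ℤ.+ + 2 ℤ.* + c   ≡⟨ cong (λ w → + neutral ℤ.+ w) (sym (ℤₚ.pos-* 2 c)) ⟩
      + neutral ℤ.+ + (2 * c)     ≡⟨ sym (ℤₚ.pos-+ neutral (2 * c)) ⟩
      + (neutral + 2 * c)         ≡⟨ cong +_ neutral+2fix ⟩
      + (2 * a + 2 * b)           ≡⟨ trans (ℤₚ.pos-+ (2 * a) (2 * b)) (cong₂ ℤ._+_ (ℤₚ.pos-* 2 a) (ℤₚ.pos-* 2 b)) ⟩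
      + 2 ℤ.* + a ℤ.+ + 2 ℤ.* + b ∎))
    where
    open ≡-Reasoning
    x≡x+y-y : ∀ x y → x ≡ x ℤ.+ y ℤ.- y
    x≡x+y-y = ℤ-Solver.solve-∀

  +gaining≡ : + gaining ≡ + n ℤ.- + c ℤ.- + neutral
  +gaining≡ = trans (y≡x+y+z-z-x (+ neutral) (+ gaining) (+ c)) (cong (λ w → w ℤ.- + c ℤ.- + neutral)
    (trans (cong (ℤ._+ + c) (sym (ℤₚ.pos-+ neutral gaining))) (trans (sym (ℤₚ.pos-+ (neutral + gaining) c)) (cong +_ neutral+gaining+fix≡n))))
    where
    y≡x+y+z-z-x : ∀ x y z → y ≡ x ℤ.+ y ℤ.+ z ℤ.- z ℤ.- x
    y≡x+y+z-z-x = ℤ-Solver.solve-∀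

  fixed-coefficient : + c ℤ.* + 𝟙 viaFixed ≡ (r ℤ.+ + 1) ℤ.* + 𝟙 viaFixed
  fixed-coefficient = *-𝟙-cong viaFixed (+ c) (r ℤ.+ + 1) (λ e → proj₂ (proj₂ (statsAre-sound t s (r ℤ.+ + 1) a b c e)))

  neutral-coefficient : + neutral ℤ.* + 𝟙 viaNeutral ≡ neutralCoefficient ℤ.* + 𝟙 viaNeutral
  neutral-coefficient = *-𝟙-cong viaNeutral (+ neutral) neutralCoefficient onClass
    where
    onClass : viaNeutral ≡ true → + neutral ≡ neutralCoefficient
    onClass e with statsAre-sound t s r a b c e
    ... | a≡t , b≡s , c≡r = trans +neutral≡ (cong₂ (λ X Y → X ℤ.- + 2 ℤ.* Y) (cong₂ (λ T S → + 2 ℤ.* T ℤ.+ + 2 ℤ.* S) a≡t b≡s) c≡r)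

  gain-coefficient : + gaining ℤ.* + 𝟙 viaGain ≡ gainCoefficient ℤ.* + 𝟙 viaGain
  gain-coefficient = *-𝟙-cong viaGain (+ gaining) gainCoefficient onClass
    where
    regroup : ∀ m a b c → m ℤ.- c ℤ.- (+ 2 ℤ.* a ℤ.+ + 2 ℤ.* b ℤ.- + 2 ℤ.* c) ≡ m ℤ.+ + 2 ℤ.- + 2 ℤ.* (a ℤ.+ + 1) ℤ.- + 2 ℤ.* b ℤ.+ c
    regroup = ℤ-Solver.solve-∀
    onClass : viaGain ≡ true → + gaining ≡ gainCoefficient
    onClass e with statsAre-sound (t ℤ.- + 1) s r a b c e
    ... | a≡t-1 , b≡s , c≡r = trans +gaining≡ (trans (cong (λ w → + n ℤ.- + c ℤ.- w) +neutral≡) (trans (regroup (+ n) (+ a) (+ b) (+ c))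
      (cong₂ (λ X R → X ℤ.+ R) (cong₂ (λ T S → + n ℤ.+ + 2 ℤ.- + 2 ℤ.* T ℤ.- + 2 ℤ.* S) (trans (cong (ℤ._+ + 1) a≡t-1) (t-1+1 t)) b≡s) c≡r)))
      where
      t-1+1 : ∀ t → t ℤ.- + 1 ℤ.+ + 1 ≡ t
      t-1+1 = ℤ-Solver.solve-∀

  classCount-ℤ : + classCount t s r σ ≡
    (neutralCoefficient ℤ.* + 𝟙 viaNeutral ℤ.+ + 𝟙 viaNewFixed) ℤ.+ ((r ℤ.+ + 1) ℤ.* + 𝟙 viaFixed ℤ.+ gainCoefficient ℤ.* + 𝟙 viaGain)
  classCount-ℤ = begin
      + classCount t s r σ
        ≡⟨ cong +_ classCount≡ ⟩
      + (𝟙 viaNewFixed + (c * 𝟙 viaFixed + (neutral * 𝟙 viaNeutral + gaining * 𝟙 viaGain)))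
        ≡⟨ ℤₚ.pos-+ (𝟙 viaNewFixed) _ ⟩
      + 𝟙 viaNewFixed ℤ.+ + (c * 𝟙 viaFixed + (neutral * 𝟙 viaNeutral + gaining * 𝟙 viaGain))
        ≡⟨ cong (λ w → + 𝟙 viaNewFixed ℤ.+ w) (trans (ℤₚ.pos-+ (c * 𝟙 viaFixed) _) (cong₂ ℤ._+_ (ℤₚ.pos-* c (𝟙 viaFixed))
             (trans (ℤₚ.pos-+ (neutral * 𝟙 viaNeutral) _) (cong₂ ℤ._+_ (ℤₚ.pos-* neutral (𝟙 viaNeutral)) (ℤₚ.pos-* gaining (𝟙 viaGain)))))) ⟩
      + 𝟙 viaNewFixed ℤ.+ (+ c ℤ.* + 𝟙 viaFixed ℤ.+ (+ neutral ℤ.* + 𝟙 viaNeutral ℤ.+ + gaining ℤ.* + 𝟙 viaGain))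
        ≡⟨ cong₂ (λ X Y → + 𝟙 viaNewFixed ℤ.+ (X ℤ.+ Y)) fixed-coefficient (cong₂ ℤ._+_ neutral-coefficient gain-coefficient) ⟩
      + 𝟙 viaNewFixed ℤ.+ ((r ℤ.+ + 1) ℤ.* + 𝟙 viaFixed ℤ.+ (neutralCoefficient ℤ.* + 𝟙 viaNeutral ℤ.+ gainCoefficient ℤ.* + 𝟙 viaGain))
        ≡⟨ regroup (+ 𝟙 viaNewFixed) ((r ℤ.+ + 1) ℤ.* + 𝟙 viaFixed) (neutralCoefficient ℤ.* + 𝟙 viaNeutral) (gainCoefficient ℤ.* + 𝟙 viaGain) ⟩
      (neutralCoefficient ℤ.* + 𝟙 viaNeutral ℤ.+ + 𝟙 viaNewFixed) ℤ.+ ((r ℤ.+ + 1) ℤ.* + 𝟙 viaFixed ℤ.+ gainCoefficient ℤ.* + 𝟙 viaGain) ∎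
    where
    open ≡-Reasoning
    regroup : ∀ w x y z → w ℤ.+ (x ℤ.+ (y ℤ.+ z)) ≡ (y ℤ.+ w) ℤ.+ (x ℤ.+ z)
    regroup = ℤ-Solver.solve-∀

mainTheorem4 : (n : ℕ) → n ≥ 1 → (t s r : ℤ) →
    + v (suc n) t s r ≡
    ((+ 2 ℤ.* t ℤ.+ + 2 ℤ.* s ℤ.- + 2 ℤ.* r) ℤ.* + v n t s r
    ℤ.+ + v n t (s ℤ.- + 1) (r ℤ.- + 1))
    ℤ.+ ((r ℤ.+ + 1) ℤ.* + v n t s (r ℤ.+ + 1)
    ℤ.+ (+ n ℤ.+ + 2 ℤ.- + 2 ℤ.* t ℤ.- + 2 ℤ.* s ℤ.+ r) ℤ.* + v n (t ℤ.- + 1) s r)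
mainTheorem4 n _ t s r = begin
    + v (suc n) t s r                               ≡⟨ cong +_ (v-suc≡∑classCount n t s r) ⟩
    + ∑ (classCount t s r) (Sym n)                  ≡⟨ +∑≡∑ℤ (classCount t s r) (Sym n) ⟩
    ∑ℤ (λ σ → + classCount t s r σ) (Sym n)         ≡⟨ ∑ℤ-cong (Sym n) (λ σ σ∈ → ClassCount.classCount-ℤ σ (Sym⇒Inj σ σ∈) t s r) ⟩
    ∑ℤ (λ σ → (A ℤ.* I t s r σ ℤ.+ I t (s ℤ.- + 1) (r ℤ.- + 1) σ) ℤ.+ (R ℤ.* I t s (r ℤ.+ + 1) σ ℤ.+ C ℤ.* I (t ℤ.- + 1) s r σ)) (Sym n)
      ≡⟨ ∑ℤ-linear A R C _ _ _ _ (Sym n) ⟩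
    (A ℤ.* ∑ℤ (I t s r) (Sym n) ℤ.+ ∑ℤ (I t (s ℤ.- + 1) (r ℤ.- + 1)) (Sym n)) ℤ.+ (R ℤ.* ∑ℤ (I t s (r ℤ.+ + 1)) (Sym n) ℤ.+ C ℤ.* ∑ℤ (I (t ℤ.- + 1) s r) (Sym n))
      ≡⟨ cong₂ ℤ._+_ (cong₂ (λ X Y → A ℤ.* X ℤ.+ Y) (∑ℤ-inClass n t s r) (∑ℤ-inClass n t (s ℤ.- + 1) (r ℤ.- + 1)))
                     (cong₂ (λ X Y → R ℤ.* X ℤ.+ C ℤ.* Y) (∑ℤ-inClass n t s (r ℤ.+ + 1)) (∑ℤ-inClass n (t ℤ.- + 1) s r)) ⟩
    (A ℤ.* + v n t s r ℤ.+ + v n t (s ℤ.- + 1) (r ℤ.- + 1)) ℤ.+ (R ℤ.* + v n t s (r ℤ.+ + 1) ℤ.+ C ℤ.* + v n (t ℤ.- + 1) s r) ∎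
  where
  open ≡-Reasoning
  A = + 2 ℤ.* t ℤ.+ + 2 ℤ.* s ℤ.- + 2 ℤ.* r
  R = r ℤ.+ + 1
  C = + n ℤ.+ + 2 ℤ.- + 2 ℤ.* t ℤ.- + 2 ℤ.* s ℤ.+ r
  I : ℤ → ℤ → ℤ → Vec (Fin n) n → ℤ
  I t′ s′ r′ σ = + 𝟙 (inClass t′ s′ r′ σ)
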